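{- Let $G$ be a matching covered graph, let $C:=\partial(X)$ be a tight cut of $G$, let $B$ be a barrier of $G$, let $\mathcal{H}$ be the set of components of $G-B$, and for each shore $Z$ of $C$ let $\mathcal{H}_Z$ be the set of components $H\in\mathcal{H}$ with $|V(H)\cap Z|$ odd. Let $K$ be a component in $\mathcal{H}_X$ that contains a vertex adjacent to a vertex in $B\cap\overline{X}$. Then: (i) $|B\cap X|=|\mathcal{H}_X|-1$ and $|B\cap\overline{X}|=|\mathcal{H}_{\overline{X}}|+1$; (ii) each component in $\mathcal{H}_{\overline{X}}$ is a subgraph of $G[\overline{X}]$ and has no vertex adjacent to a vertex of $B\cap X$; (iii) $B\cap\overline{X}$ is a (possibly trivial) barrier of $G$ (and it is $C$-sheltered); (iv) if $C$ is nontrivial and $B$ is $C$-avoiding and nontrivial, then $B\cap\overline{X}$ is a nontrivial ($C$-sheltered) barrier of $G$.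
   Context: Graphs are finite, may have multiple edges, no loops. For $X\subseteq V(G)$, $\overline{X}=V(G)-X$, $\partial(X)$ is the set of edges with exactly one end in $X$; $X,\overline{X}$ are the shores of the cut $\partial(X)$, and the cut is trivial if a shore has exactly one vertex. Two cuts $\partial(X),\partial(Y)$ are laminar if at least one of $X\cap Y,\overline{X}\cap Y,X\cap\overline{Y},\overline{X}\cap\overline{Y}$ is empty. A graph is matching covered if it is connected, has at least one edge, and every edge lies in some perfect matching. A cut $C$ is tight if $|C\cap M|=1$ for every perfect matching $M$. A barrier is a nonempty vertex set $B$ with $o(G-B)=|B|$ ($o$ = number of odd components); it is nontrivial if $|B|\ge2$. A vertex set is $C$-sheltered if it is a subset of a shore of $C$. A barrier $B$ is $C$-avoiding if for every component $H$ of $G-B$ the cut $\partial(V(H))$ is laminar with $C$. -}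

module Defs where

open import Data.Nat using (ℕ; zero; suc; _≤_; _%_; _+_)
open import Data.Nat.Properties using (_≟_)
open import Data.Fin using (Fin)
import Data.Fin.Properties as FinP
open import Data.Fin.Subset using (Subset; _∈_; _∉_; _⊆_; ∁; _∩_; ∣_∣; Nonempty; Empty)
open import Data.Vec using (tabulate)
open import Data.Bool using (Bool; true; false; _∨_; _xor_)
open import Data.Product using (Σ; _×_; _,_; proj₁; proj₂; ∃; ∃-syntax)
open import Data.Sum using (_⊎_)
open import Data.List using (List; filter; length)
open import Data.List.Membership.Propositional using () renaming (_∈_ to _∈ₗ_)
open import Data.List.Relation.Unary.Unique.Propositional using (Unique)
open import Relation.Nullary using (¬_; Dec; does)
open import Relation.Binary.PropositionalEquality using (_≡_; _≢_)
open import Function.Bundles using (_⇔_)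

record Graph : Set where
  field
    n     : ℕ
    m     : ℕ
    ends  : Fin m → Fin n × Fin n
    noLoop : ∀ e → proj₁ (ends e) ≢ proj₂ (ends e)
open Graph public

VSet : Graph → Set
VSet G = Subset (n G)

ESet : Graph → Set
ESet G = Subset (m G)

memb : ∀ {k} → Fin k → Subset k → Bool
memb v X = Data.Vec.lookup X v

incident : (G : Graph) → Fin (n G) → ESet G
incident G v = tabulate λ e → does (v FinP.≟ proj₁ (ends G e)) ∨ does (v FinP.≟ proj₂ (ends G e))

Adjacent : (G : Graph) → Fin (n G) → Fin (n G) → Set
Adjacent G u w = ∃[ e ] (ends G e ≡ (u , w) ⊎ ends G e ≡ (w , u))

∂ : (G : Graph) → VSet G → ESet G
∂ G X = tabulate λ e → memb (proj₁ (ends G e)) X xor memb (proj₂ (ends G e)) X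

PerfectMatching : (G : Graph) → ESet G → Set
PerfectMatching G M = ∀ v → ∣ M ∩ incident G v ∣ ≡ 1

-- walks inside a vertex set S: Reach G S u v means there is a u–v path
-- all of whose vertices lie in S (i.e. a path in G[S])
data Reach (G : Graph) (S : VSet G) : Fin (n G) → Fin (n G) → Set where
  here : ∀ {u} → u ∈ S → Reach G S u u
  step : ∀ {u w v} → u ∈ S → Adjacent G u w → Reach G S w v → Reach G S u v

Connected : Graph → Set
Connected G = ∀ u v → Reach G (tabulate λ _ → true) u v

MatchingCovered : Graph → Set
MatchingCovered G =
  Connected G × (1 ≤ m G) ×
  (∀ e → ∃[ M ] (PerfectMatching G M × e ∈ M))

Tight : (G : Graph) → ESet G → Set
Tight G C = ∀ M → PerfectMatching G M → ∣ C ∩ M ∣ ≡ 1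

-- (the vertex set of) a component of G - B:
-- a nonempty set of vertices outside B, connected in G - B, and closed
-- under reachability in G - B (i.e. a maximal connected subgraph)
IsComponent : (G : Graph) → VSet G → VSet G → Set
IsComponent G B S =
  Nonempty S × S ⊆ ∁ B ×
  (∀ {u v} → u ∈ S → v ∈ S → Reach G (∁ B) u v) ×
  (∀ {u v} → u ∈ S → Reach G (∁ B) u v → v ∈ S)

Components : (G : Graph) → VSet G → List (VSet G) → Set
Components G B Hs = Unique Hs × (∀ S → (S ∈ₗ Hs ⇔ IsComponent G B S))

IsOdd : ℕ → Set
IsOdd k = k % 2 ≡ 1

isOdd? : ∀ k → Dec (IsOdd k)
isOdd? k = (k % 2) ≟ 1

oddOnes : ∀ {k} → List (Subset k) → List (Subset k)
oddOnes = filter (λ S → isOdd? ∣ S ∣)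

oddIn : ∀ {k} → Subset k → List (Subset k) → List (Subset k)
oddIn Z = filter (λ S → isOdd? ∣ S ∩ Z ∣)

Barrier : (G : Graph) → VSet G → Set
Barrier G B = Nonempty B × ∃[ Hs ] (Components G B Hs × length (oddOnes Hs) ≡ ∣ B ∣)

-- the cuts ∂(X) and ∂(Y) are laminar
Laminar : ∀ {k} → Subset k → Subset k → Set
Laminar X Y = Empty (X ∩ Y) ⊎ Empty (∁ X ∩ Y) ⊎ Empty (X ∩ ∁ Y) ⊎ Empty (∁ X ∩ ∁ Y)

NontrivialCut : ∀ {k} → Subset k → Set
NontrivialCut X = 2 ≤ ∣ X ∣ × 2 ≤ ∣ ∁ X ∣

Sheltered : ∀ {k} → Subset k → Subset k → Set
Sheltered X S = S ⊆ X ⊎ S ⊆ ∁ X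

Avoiding : (G : Graph) → VSet G → VSet G → Set
Avoiding G X B = ∀ H → IsComponent G B H → Laminar H X

-- A perfect matching M is a fixed-point-free involution v ↦ mate v, and the vertices of a set A whose mate
-- leaves A have the parity of |A|. For the barrier B every component H of G - B is odd (G is matching covered),
-- M matches no two vertices of B, and each H has exactly one vertex matched into B. The tight cut ∂X carries one
-- edge of M, so |H ∩ X| ≡ c(H) + γ(H) (mod 2), where γ(H) ≤ 1 counts vertices of H matched into B ∩ X and c(H)
-- counts the cut edge at H, with Σ c = 1 and Σ γ = |B ∩ X|. Hence the number of components odd on X differs from
-- |B ∩ X| only through the single component carrying the cut edge, and the matching through the edge from K to
-- B - X makes that difference +1, giving (i). For any other M, a component odd on ∁X can then receive neither a
-- matching edge from B ∩ X nor the cut edge, giving (ii); such components are components of G - (B ∩ ∁X), and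
-- since o(G - S) ≤ |S| with o(G - S) ≡ |S| (mod 2) for every S, there are exactly |B ∩ ∁X| odd ones, giving (iii).
-- In (iv), if |B ∩ ∁X| = 1 every component is odd on X and laminarity puts it inside X, so ∁X ⊆ B ∩ ∁X.

module Submission where

open import Defs
open import Data.Nat using (_≤_; _+_)
open import Data.Fin.Subset using (_∈_; _∉_; _⊆_; ∁; _∩_; ∣_∣)
open import Data.Product using (_×_; ∃; ∃-syntax)
open import Data.List using (List; length)
open import Data.List.Membership.Propositional using () renaming (_∈_ to _∈ₗ_)
open import Relation.Nullary using (¬_)
open import Relation.Binary.PropositionalEquality using (_≡_)

open import Data.Nat using (ℕ; zero; suc; z≤n; s≤s; _<_; _*_; _%_)
open import Data.Nat.Properties as ℕ using (≤-refl; ≤-trans; +-mono-≤; +-comm; +-assoc; module ≤-Reasoning)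
open import Data.Nat.DivMod using ([m+n]%n≡m%n)
open import Data.Nat.Tactic.RingSolver using (solve-∀)
open import Data.Fin as Fin using (Fin; zero; suc)
import Data.Fin.Properties as Fin
open import Data.Fin.Subset using (Subset; Nonempty; Empty)
open import Data.Fin.Subset.Properties
  using (_∈?_; x∈p∩q⁺; x∈p∩q⁻; x∈∁p⇒x∉p; x∉p⇒x∈∁p; p⊆q⇒∣p∣≤∣q∣; Empty-unique; ∣⊥∣≡0)
import Data.Fin.Permutation as Permutation
open import Data.Bool as Bool using (Bool; true; false; _∧_; _∨_; not; _xor_; if_then_else_)
import Data.Bool.Properties as Bool
open import Data.Vec using (lookup; tabulate; []; _∷_)
import Data.Vec.Properties as Vec
open import Data.Product using (Σ; _,_; proj₁; proj₂)
import Data.Product.Properties as Product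
open import Data.Sum using (_⊎_; inj₁; inj₂)
open import Data.Empty using (⊥-elim)
open import Data.List as List using ([]; _∷_; _++_; filter)
open import Data.List.Relation.Unary.Any using (here; there)
import Data.List.Relation.Unary.All as All
open import Data.List.Relation.Unary.AllPairs using ([]; _∷_)
open import Data.List.Relation.Unary.Unique.Propositional using (Unique)
import Data.List.Membership.Propositional.Properties as Membership
import Data.List.Relation.Unary.Unique.Propositional.Properties as Unique
import Data.List.Relation.Unary.Unique.DecPropositional.Properties as DecUnique
open import Relation.Nullary using (Dec; yes; no; does)
open import Relation.Nullary.Decidable using (dec-true; dec-false; _⊎-dec_; _×-dec_; _→-dec_; ¬?)
open import Relation.Binary using (tri<; tri≈; tri>)
open import Relation.Binary.PropositionalEquality
  using (refl; sym; trans; cong; cong₂; subst; _≢_; module ≡-Reasoning)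
open import Function using (_∘_)
open import Function.Bundles using (Equivalence; mk⇔)
open import Algebra.Properties.CommutativeMonoid.Sum ℕ.+-0-commutativeMonoid
  using (sum; ∑-distrib-+; ∑-comm; ∑-permute; sum-cong-≗)

does≡true⇒ : ∀ {P : Set} (d : Dec P) → does d ≡ true → P
does≡true⇒ (yes p) _ = p

∧-true⁻ : ∀ {a b} → a ∧ b ≡ true → (a ≡ true) × (b ≡ true)
∧-true⁻ {true} {true} _ = refl , refl

∧-true⁺ : ∀ {a b} → a ≡ true → b ≡ true → a ∧ b ≡ true
∧-true⁺ refl refl = refl

∨-true⁻ : ∀ {a b} → a ∨ b ≡ true → (a ≡ true) ⊎ (b ≡ true)
∨-true⁻ {true} _ = inj₁ refl
∨-true⁻ {false} e = inj₂ e

true≢false : true ≢ false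
true≢false ()

true-or-false : ∀ (b : Bool) → (b ≡ true) ⊎ (b ≡ false)
true-or-false true = inj₁ refl
true-or-false false = inj₂ refl

bool-ext : ∀ {a b : Bool} → (a ≡ true → b ≡ true) → (b ≡ true → a ≡ true) → a ≡ b
bool-ext {true} f _ = sym (f refl)
bool-ext {false} {true} _ g = g refl
bool-ext {false} {false} _ _ = refl

𝟙 : Bool → ℕ
𝟙 true = 1
𝟙 false = 0

𝟙≤1 : ∀ b → 𝟙 b ≤ 1
𝟙≤1 true = s≤s z≤n
𝟙≤1 false = z≤n

count : ∀ {k} → (Fin k → Bool) → ℕ
count f = sum (λ v → 𝟙 (f v))

sum-mono : ∀ {k} (f g : Fin k → ℕ) → (∀ v → f v ≤ g v) → sum f ≤ sum g
sum-mono {zero} f g h = z≤n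
sum-mono {suc k} f g h = +-mono-≤ (h zero) (sum-mono (f ∘ suc) (g ∘ suc) (h ∘ suc))

term≤sum : ∀ {k} (f : Fin k → ℕ) v → f v ≤ sum f
term≤sum f zero = ℕ.m≤m+n _ _
term≤sum f (suc v) = ≤-trans (term≤sum (f ∘ suc) v) (ℕ.m≤n+m _ (f zero))

two-terms≤sum : ∀ {k} (f : Fin k → ℕ) a b → a ≢ b → f a + f b ≤ sum f
two-terms≤sum f zero zero a≢b = ⊥-elim (a≢b refl)
two-terms≤sum f zero (suc b) _ = +-mono-≤ (≤-refl {f zero}) (term≤sum (f ∘ suc) b)
two-terms≤sum f (suc a) zero _ =
  ≤-trans (ℕ.≤-reflexive (+-comm (f (suc a)) (f zero))) (+-mono-≤ (≤-refl {f zero}) (term≤sum (f ∘ suc) a))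
two-terms≤sum f (suc a) (suc b) a≢b =
  ≤-trans (two-terms≤sum (f ∘ suc) a b (a≢b ∘ cong suc)) (ℕ.m≤n+m _ (f zero))

sum-bound : ∀ {k} (f : Fin k → ℕ) c → (∀ v → f v ≤ c) → sum f ≤ k * c
sum-bound {zero} f c h = z≤n
sum-bound {suc k} f c h = +-mono-≤ (h zero) (sum-bound (f ∘ suc) c (h ∘ suc))

sum-pos⇒∃ : ∀ {k} (f : Fin k → ℕ) → 1 ≤ sum f → ∃[ v ] (1 ≤ f v)
sum-pos⇒∃ {suc k} f h with f zero in eq
... | suc _ = zero , subst (1 ≤_) (sym eq) (s≤s z≤n)
... | zero with sum-pos⇒∃ (f ∘ suc) h
... | v , q = suc v , q

sum-zeros : ∀ {k} (f : Fin k → ℕ) → (∀ v → f v ≡ 0) → sum f ≡ 0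
sum-zeros {zero} f h = refl
sum-zeros {suc k} f h = cong₂ _+_ (h zero) (sum-zeros (f ∘ suc) (h ∘ suc))

sum-single : ∀ {k} (f : Fin k → ℕ) a → (∀ v → v ≢ a → f v ≡ 0) → sum f ≡ f a
sum-single f zero h = trans (cong (f zero +_) (sum-zeros (f ∘ suc) (λ v → h (suc v) (λ ())))) (ℕ.+-identityʳ _)
sum-single f (suc a) h =
  trans (cong (_+ sum (f ∘ suc)) (h zero (λ ()))) (sum-single (f ∘ suc) a (λ v v≢a → h (suc v) (v≢a ∘ Fin.suc-injective)))

sum-involution : ∀ {k} (σ : Fin k → Fin k) → (∀ v → σ (σ v) ≡ v) → (f : Fin k → ℕ) → sum (f ∘ σ) ≡ sum f
sum-involution σ σσ f = sym (∑-permute f (Permutation.permutation σ σ σσ σσ))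

count-cong : ∀ {k} (f g : Fin k → Bool) → (∀ v → f v ≡ g v) → count f ≡ count g
count-cong f g f≗g = sum-cong-≗ (cong 𝟙 ∘ f≗g)

count-split : ∀ {k} (f g : Fin k → Bool) → count f ≡ count (λ v → f v ∧ g v) + count (λ v → f v ∧ not (g v))
count-split f g = trans (sum-cong-≗ (λ v → 𝟙-split (f v) (g v))) (∑-distrib-+ (λ v → 𝟙 (f v ∧ g v)) (λ v → 𝟙 (f v ∧ not (g v))))
  where
  𝟙-split : ∀ b c → 𝟙 b ≡ 𝟙 (b ∧ c) + 𝟙 (b ∧ not c)
  𝟙-split true true = refl
  𝟙-split true false = refl
  𝟙-split false c = refl

count-mono : ∀ {k} (f g : Fin k → Bool) → (∀ v → f v ≡ true → g v ≡ true) → count f ≤ count g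
count-mono f g f⇒g = sum-mono _ _ (λ v → 𝟙-mono (f v) (g v) (f⇒g v))
  where
  𝟙-mono : ∀ b c → (b ≡ true → c ≡ true) → 𝟙 b ≤ 𝟙 c
  𝟙-mono true c h rewrite h refl = ≤-refl
  𝟙-mono false c h = z≤n

count-pos⇒∃ : ∀ {k} (f : Fin k → Bool) → 1 ≤ count f → ∃[ v ] (f v ≡ true)
count-pos⇒∃ f h with sum-pos⇒∃ _ h
... | v , q with f v in e
... | true = v , e

count-pos : ∀ {k} (f : Fin k → Bool) v → f v ≡ true → 1 ≤ count f
count-pos f v e = ≤-trans (subst (λ b → 1 ≤ 𝟙 b) (sym e) ≤-refl) (term≤sum _ v)

count≥2 : ∀ {k} (f : Fin k → Bool) a b → a ≢ b → f a ≡ true → f b ≡ true → 2 ≤ count f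
count≥2 f a b a≢b fa fb = ≤-trans (two fa fb) (two-terms≤sum _ a b a≢b)
  where
  two : ∀ {x y} → x ≡ true → y ≡ true → 2 ≤ 𝟙 x + 𝟙 y
  two refl refl = ≤-refl

count-none : ∀ {k} (f : Fin k → Bool) → (∀ v → f v ≡ false) → count f ≡ 0
count-none f h = sum-zeros _ (cong 𝟙 ∘ h)

count-true : ∀ {k} → count {k} (λ _ → true) ≡ k
count-true {zero} = refl
count-true {suc k} = cong suc (count-true {k})

count≤size : ∀ {k} (f : Fin k → Bool) → count f ≤ k
count≤size {k} f = subst (count f ≤_) (ℕ.*-identityʳ k) (sum-bound _ 1 (𝟙≤1 ∘ f))

count-involution : ∀ {k} (σ : Fin k → Fin k) → (∀ v → σ (σ v) ≡ v) → (f : Fin k → Bool) → count (f ∘ σ) ≡ count f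
count-involution σ σσ f = sum-involution σ σσ (𝟙 ∘ f)

count-single : ∀ {k} (f : Fin k → Bool) a → count (λ v → does (v Fin.≟ a) ∧ f v) ≡ 𝟙 (f a)
count-single f a =
  trans (sum-single _ a (λ v v≢a → cong (λ b → 𝟙 (b ∧ f v)) (dec-false (v Fin.≟ a) v≢a)))
        (cong (λ b → 𝟙 (b ∧ f a)) (dec-true (a Fin.≟ a) refl))

count-< : ∀ {k} (f g : Fin k → Bool) → (∀ v → f v ≡ true → g v ≡ true) →
          ∀ v → g v ≡ true → f v ≡ false → count f < count g
count-< f g f⇒g v gv fv = begin
    suc (count f)   ≡⟨ +-comm 1 (count f) ⟩
    count f + 1     ≤⟨ +-mono-≤ (ℕ.≤-reflexive (sym g∧f≡f)) (count-pos (λ x → g x ∧ not (f x)) v (∧-true⁺ gv (cong not fv))) ⟩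
    count (λ x → g x ∧ f x) + count (λ x → g x ∧ not (f x)) ≡⟨ sym (count-split g f) ⟩
    count g ∎
  where
  open ≤-Reasoning
  g∧f≡f : count (λ x → g x ∧ f x) ≡ count f
  g∧f≡f = count-cong _ _ λ x → bool-ext (proj₂ ∘ ∧-true⁻) (λ fx → ∧-true⁺ (f⇒g x fx) fx)

χ : ∀ {k} → Subset k → Fin k → Bool
χ A v = lookup A v

∈⇒χ : ∀ {k} {A : Subset k} {v} → v ∈ A → χ A v ≡ true
∈⇒χ = Vec.[]=⇒lookup

χ⇒∈ : ∀ {k} {A : Subset k} {v} → χ A v ≡ true → v ∈ A
χ⇒∈ {A = A} {v} = Vec.lookup⇒[]= v A

∉⇒χ≡false : ∀ {k} {A : Subset k} {v} → v ∉ A → χ A v ≡ false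
∉⇒χ≡false {A = A} {v} v∉A with χ A v in eq
... | true = ⊥-elim (v∉A (χ⇒∈ eq))
... | false = refl

χ∩ : ∀ {k} (A C : Subset k) v → χ (A ∩ C) v ≡ χ A v ∧ χ C v
χ∩ A C v = Vec.lookup-zipWith _∧_ v A C

χ∁ : ∀ {k} (A : Subset k) v → χ (∁ A) v ≡ not (χ A v)
χ∁ A v = Vec.lookup-map v not A

∣∣≡count : ∀ {k} (A : Subset k) → ∣ A ∣ ≡ count (χ A)
∣∣≡count [] = refl
∣∣≡count (true ∷ A) = cong suc (∣∣≡count A)
∣∣≡count (false ∷ A) = ∣∣≡count A

∣∩∣≡count : ∀ {k} (A C : Subset k) → ∣ A ∩ C ∣ ≡ count (λ v → χ A v ∧ χ C v)
∣∩∣≡count A C = trans (∣∣≡count (A ∩ C)) (count-cong _ _ (χ∩ A C))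

∣∣≡∣∩∣+∣∩∁∣ : ∀ {k} (A C : Subset k) → ∣ A ∣ ≡ ∣ A ∩ C ∣ + ∣ A ∩ ∁ C ∣
∣∣≡∣∩∣+∣∩∁∣ A C = begin
  ∣ A ∣                                                       ≡⟨ ∣∣≡count A ⟩
  count (χ A)                                                  ≡⟨ count-split (χ A) (χ C) ⟩
  count (λ v → χ A v ∧ χ C v) + count (λ v → χ A v ∧ not (χ C v))
    ≡⟨ cong₂ _+_ (sym (∣∩∣≡count A C)) (count-cong _ _ (λ v → cong (χ A v ∧_) (sym (χ∁ C v)))) ⟩
  ∣ A ∩ C ∣ + count (λ v → χ A v ∧ χ (∁ C) v)                  ≡⟨ cong (∣ A ∩ C ∣ +_) (sym (∣∩∣≡count A (∁ C))) ⟩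
  ∣ A ∩ C ∣ + ∣ A ∩ ∁ C ∣ ∎
  where open ≡-Reasoning

1≤∣∣⇒Nonempty : ∀ {k} (A : Subset k) → 1 ≤ ∣ A ∣ → Nonempty A
1≤∣∣⇒Nonempty A 1≤∣A∣ with count-pos⇒∃ (χ A) (subst (1 ≤_) (∣∣≡count A) 1≤∣A∣)
... | v , e = v , χ⇒∈ e

subset-ext : ∀ {k} (A C : Subset k) → (∀ v → χ A v ≡ χ C v) → A ≡ C
subset-ext A C h = trans (sym (Vec.tabulate∘lookup A)) (trans (Vec.tabulate-cong h) (Vec.tabulate∘lookup C))

oddᵇ : ℕ → Bool
oddᵇ zero = false
oddᵇ (suc k) = not (oddᵇ k)

oddᵇ-+ : ∀ a b → oddᵇ (a + b) ≡ oddᵇ a xor oddᵇ b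
oddᵇ-+ zero b = refl
oddᵇ-+ (suc a) b rewrite oddᵇ-+ a b with oddᵇ a | oddᵇ b
... | true | true = refl
... | true | false = refl
... | false | true = refl
... | false | false = refl

oddᵇ-double : ∀ t → oddᵇ (t + t) ≡ false
oddᵇ-double t rewrite oddᵇ-+ t t with oddᵇ t
... | true = refl
... | false = refl

oddᵇ-𝟙 : ∀ b → oddᵇ (𝟙 b) ≡ b
oddᵇ-𝟙 true = refl
oddᵇ-𝟙 false = refl

𝟙-oddᵇ : ∀ x → x ≤ 1 → 𝟙 (oddᵇ x) ≡ x
𝟙-oddᵇ zero _ = refl
𝟙-oddᵇ (suc zero) _ = refl
𝟙-oddᵇ (suc (suc x)) (s≤s ())

oddᵇ⇒pos : ∀ k → oddᵇ k ≡ true → 1 ≤ k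
oddᵇ⇒pos (suc k) _ = s≤s z≤n

IsOdd⇔oddᵇ : ∀ k → (IsOdd k → oddᵇ k ≡ true) × (oddᵇ k ≡ true → IsOdd k)
IsOdd⇔oddᵇ zero = (λ ()) , (λ ())
IsOdd⇔oddᵇ (suc zero) = (λ _ → refl) , (λ _ → refl)
IsOdd⇔oddᵇ (suc (suc k)) =
  (λ o → trans (Bool.not-involutive (oddᵇ k)) (proj₁ (IsOdd⇔oddᵇ k) (trans (sym k+2%2) o))) ,
  (λ o → trans k+2%2 (proj₂ (IsOdd⇔oddᵇ k) (trans (sym (Bool.not-involutive (oddᵇ k))) o)))
  where
  k+2%2 : suc (suc k) % 2 ≡ k % 2
  k+2%2 = trans (cong (_% 2) (+-comm 2 k)) ([m+n]%n≡m%n k 2)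

squeeze-by-parity : ∀ a x → a ≤ x → x ≤ suc a → oddᵇ x ≡ oddᵇ (suc a) → x ≡ suc a
squeeze-by-parity a x a≤x x≤1+a same with ℕ.m≤n⇒m<n∨m≡n x≤1+a
... | inj₂ x≡1+a = x≡1+a
... | inj₁ (s≤s x≤a) = ⊥-elim (not-fixed (oddᵇ a) (trans (cong oddᵇ (sym (ℕ.≤-antisym x≤a a≤x))) same))
  where
  not-fixed : ∀ b → b ≢ not b
  not-fixed true ()
  not-fixed false ()

IsOdd⇒oddᵇ : ∀ k → IsOdd k → oddᵇ k ≡ true
IsOdd⇒oddᵇ k = proj₁ (IsOdd⇔oddᵇ k)

oddᵇ⇒IsOdd : ∀ k → oddᵇ k ≡ true → IsOdd k
oddᵇ⇒IsOdd k = proj₂ (IsOdd⇔oddᵇ k)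

does-isOdd? : ∀ k → does (isOdd? k) ≡ oddᵇ k
does-isOdd? k with true-or-false (oddᵇ k)
... | inj₁ t = trans (dec-true (isOdd? k) (oddᵇ⇒IsOdd k t)) (sym t)
... | inj₂ f = trans (dec-false (isOdd? k) (λ o → true≢false (trans (sym (IsOdd⇒oddᵇ k o)) f))) (sym f)

∑ₗ : ∀ {A : Set} → (A → ℕ) → List A → ℕ
∑ₗ f [] = 0
∑ₗ f (x ∷ xs) = f x + ∑ₗ f xs

∑ₗ-cong : ∀ {A : Set} (f g : A → ℕ) (xs : List A) → (∀ x → x ∈ₗ xs → f x ≡ g x) → ∑ₗ f xs ≡ ∑ₗ g xs
∑ₗ-cong f g [] h = refl
∑ₗ-cong f g (x ∷ xs) h = cong₂ _+_ (h x (here refl)) (∑ₗ-cong f g xs (λ y m → h y (there m)))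

∑ₗ-mono : ∀ {A : Set} (f g : A → ℕ) (xs : List A) → (∀ x → x ∈ₗ xs → f x ≤ g x) → ∑ₗ f xs ≤ ∑ₗ g xs
∑ₗ-mono f g [] h = z≤n
∑ₗ-mono f g (x ∷ xs) h = +-mono-≤ (h x (here refl)) (∑ₗ-mono f g xs (λ y m → h y (there m)))

∑ₗ-distrib-+ : ∀ {A : Set} (f g : A → ℕ) (xs : List A) → ∑ₗ (λ x → f x + g x) xs ≡ ∑ₗ f xs + ∑ₗ g xs
∑ₗ-distrib-+ f g [] = refl
∑ₗ-distrib-+ f g (x ∷ xs) rewrite ∑ₗ-distrib-+ f g xs = interchange (f x) (g x) (∑ₗ f xs) (∑ₗ g xs)
  where
  interchange : ∀ a b c d → (a + b) + (c + d) ≡ (a + c) + (b + d)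
  interchange = solve-∀

∑ₗ-∑-comm : ∀ {A : Set} {k} (g : A → Fin k → ℕ) (xs : List A) → ∑ₗ (λ a → sum (g a)) xs ≡ sum (λ v → ∑ₗ (λ a → g a v) xs)
∑ₗ-∑-comm {k = k} g [] = sym (sum-zeros {k} (λ _ → 0) (λ _ → refl))
∑ₗ-∑-comm g (x ∷ xs) = trans (cong (sum (g x) +_) (∑ₗ-∑-comm g xs)) (sym (∑-distrib-+ (g x) (λ v → ∑ₗ (λ a → g a v) xs)))

∑ₗ-1≡length : ∀ {A : Set} (xs : List A) → ∑ₗ (λ _ → 1) xs ≡ length xs
∑ₗ-1≡length [] = refl
∑ₗ-1≡length (x ∷ xs) = cong suc (∑ₗ-1≡length xs)

length-filter : ∀ {A : Set} {P : A → Set} (P? : ∀ x → Dec (P x)) (xs : List A) →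
                length (filter P? xs) ≡ ∑ₗ (λ x → 𝟙 (does (P? x))) xs
length-filter P? [] = refl
length-filter P? (x ∷ xs) with does (P? x)
... | true = cong suc (length-filter P? xs)
... | false = length-filter P? xs

term≤∑ₗ : ∀ {A : Set} (f : A → ℕ) {x} {xs : List A} → x ∈ₗ xs → f x ≤ ∑ₗ f xs
term≤∑ₗ f (here refl) = ℕ.m≤m+n _ _
term≤∑ₗ f {xs = y ∷ _} (there m) = ≤-trans (term≤∑ₗ f m) (ℕ.m≤n+m _ (f y))

∑ₗ≡0⇒term≡0 : ∀ {A : Set} (f : A → ℕ) {x} {xs : List A} → x ∈ₗ xs → ∑ₗ f xs ≡ 0 → f x ≡ 0
∑ₗ≡0⇒term≡0 f m e = ℕ.n≤0⇒n≡0 (subst (_ ≤_) e (term≤∑ₗ f m))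

∑ₗ-zeros : ∀ {A : Set} (f : A → ℕ) (xs : List A) → (∀ x → x ∈ₗ xs → f x ≡ 0) → ∑ₗ f xs ≡ 0
∑ₗ-zeros f [] h = refl
∑ₗ-zeros f (x ∷ xs) h = cong₂ _+_ (h x (here refl)) (∑ₗ-zeros f xs (λ y m → h y (there m)))

oddᵇ-∑ₗ : ∀ {A : Set} (f : A → ℕ) (xs : List A) → oddᵇ (∑ₗ f xs) ≡ oddᵇ (∑ₗ (λ x → 𝟙 (oddᵇ (f x))) xs)
oddᵇ-∑ₗ f [] = refl
oddᵇ-∑ₗ f (x ∷ xs) =
  trans (oddᵇ-+ (f x) _) (trans (cong₂ _xor_ (sym (oddᵇ-𝟙 (oddᵇ (f x)))) (oddᵇ-∑ₗ f xs)) (sym (oddᵇ-+ (𝟙 (oddᵇ (f x))) _)))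

∑ₗ-≤-≡⇒≡ : ∀ {A : Set} (f g : A → ℕ) (xs : List A) → (∀ x → x ∈ₗ xs → f x ≤ g x) →
           ∑ₗ f xs ≡ ∑ₗ g xs → ∀ x → x ∈ₗ xs → f x ≡ g x
∑ₗ-≤-≡⇒≡ f g (y ∷ ys) f≤g eq x x∈ with ℕ.≤-antisym (f≤g y (here refl)) gy≤fy
  where
  gy≤fy : g y ≤ f y
  gy≤fy = ℕ.+-cancelʳ-≤ (∑ₗ f ys) _ _
    (≤-trans (+-mono-≤ (≤-refl {g y}) (∑ₗ-mono f g ys (λ z m → f≤g z (there m)))) (ℕ.≤-reflexive (sym eq)))
∑ₗ-≤-≡⇒≡ f g (y ∷ ys) f≤g eq x (here refl) | fy≡gy = fy≡gy
∑ₗ-≤-≡⇒≡ f g (y ∷ ys) f≤g eq x (there x∈) | fy≡gy =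
  ∑ₗ-≤-≡⇒≡ f g ys (λ z m → f≤g z (there m)) (ℕ.+-cancelˡ-≡ (f y) _ _ (trans eq (cong (_+ ∑ₗ g ys) (sym fy≡gy)))) x x∈

∑ₗ-agree-off-unique-support : ∀ {A : Set} (d f g : A → ℕ) {x} (xs : List A) → x ∈ₗ xs → 1 ≤ d x → ∑ₗ d xs ≤ 1 →
                              (∀ y → y ∈ₗ xs → d y ≡ 0 → f y ≡ g y) → ∑ₗ f xs + g x ≡ ∑ₗ g xs + f x
∑ₗ-agree-off-unique-support d f g (y ∷ ys) (here refl) 1≤dy ∑d≤1 agree = begin
    (f y + ∑ₗ f ys) + g y ≡⟨ cong (λ t → (f y + t) + g y) (∑ₗ-cong f g ys (λ z m → agree z (there m) (∑ₗ≡0⇒term≡0 d m rest0))) ⟩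
    (f y + ∑ₗ g ys) + g y ≡⟨ swap-outer (f y) (∑ₗ g ys) (g y) ⟩
    (g y + ∑ₗ g ys) + f y ∎
  where
  open ≡-Reasoning
  rest0 : ∑ₗ d ys ≡ 0
  rest0 = ℕ.n≤0⇒n≡0 (ℕ.+-cancelˡ-≤ 1 _ _ (≤-trans (+-mono-≤ 1≤dy (≤-refl {∑ₗ d ys})) ∑d≤1))
  swap-outer : ∀ a b c → (a + b) + c ≡ (c + b) + a
  swap-outer = solve-∀
∑ₗ-agree-off-unique-support d f g (y ∷ ys) (there x∈) 1≤dx ∑d≤1 agree = begin
    (f y + ∑ₗ f ys) + _ ≡⟨ +-assoc (f y) _ _ ⟩
    f y + (∑ₗ f ys + _) ≡⟨ cong₂ _+_ (agree y (here refl) dy≡0) rest ⟩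
    g y + (∑ₗ g ys + _) ≡⟨ sym (+-assoc (g y) _ _) ⟩
    (g y + ∑ₗ g ys) + _ ∎
  where
  open ≡-Reasoning
  dy≡0 : d y ≡ 0
  dy≡0 = ℕ.n≤0⇒n≡0 (ℕ.+-cancelˡ-≤ 1 (d y) 0
           (subst (_≤ 1) (+-comm (d y) 1) (≤-trans (+-mono-≤ (≤-refl {d y}) (≤-trans 1≤dx (term≤∑ₗ d x∈))) ∑d≤1)))
  rest = ∑ₗ-agree-off-unique-support d f g ys x∈ 1≤dx (≤-trans (ℕ.m≤n+m _ (d y)) ∑d≤1) (λ z m → agree z (there m))

∑ₗ-𝟙-unique : ∀ {A : Set} (b : A → Bool) {x} (xs : List A) → Unique xs → x ∈ₗ xs → b x ≡ true →
              (∀ y → y ∈ₗ xs → b y ≡ true → y ≡ x) → ∑ₗ (𝟙 ∘ b) xs ≡ 1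
∑ₗ-𝟙-unique b (y ∷ ys) (y∉ys ∷ _) (here refl) bx only-x = cong₂ _+_ (cong 𝟙 bx) (∑ₗ-zeros _ ys rest)
  where
  rest : ∀ z → z ∈ₗ ys → 𝟙 (b z) ≡ 0
  rest z m with true-or-false (b z)
  ... | inj₁ t = ⊥-elim (All.lookup y∉ys m (sym (only-x z (there m) t)))
  ... | inj₂ f = cong 𝟙 f
∑ₗ-𝟙-unique b (y ∷ ys) (y∉ys ∷ u) (there x∈) bx only-x with true-or-false (b y)
... | inj₁ t = ⊥-elim (All.lookup y∉ys x∈ (only-x y (here refl) t))
... | inj₂ f = cong₂ _+_ (cong 𝟙 f) (∑ₗ-𝟙-unique b ys u x∈ bx (λ z m → only-x z (there m)))

Unique⇒length-≤ : ∀ {A : Set} (xs ys : List A) → Unique xs → (∀ x → x ∈ₗ xs → x ∈ₗ ys) → length xs ≤ length ys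
Unique⇒length-≤ [] ys _ _ = z≤n
Unique⇒length-≤ (x ∷ xs) ys (x∉xs ∷ u) xs⊆ys with Membership.∈-∃++ (xs⊆ys x (here refl))
... | ys₁ , ys₂ , refl =
  subst (suc (length xs) ≤_) (sym (length-middle ys₁)) (s≤s (Unique⇒length-≤ xs (ys₁ ++ ys₂) u xs⊆ys₁++ys₂))
  where
  length-middle : ∀ zs → length (zs ++ x ∷ ys₂) ≡ suc (length (zs ++ ys₂))
  length-middle [] = refl
  length-middle (_ ∷ zs) = cong suc (length-middle zs)
  xs⊆ys₁++ys₂ : ∀ z → z ∈ₗ xs → z ∈ₗ (ys₁ ++ ys₂)
  xs⊆ys₁++ys₂ z m with Membership.∈-++⁻ ys₁ (xs⊆ys z (there m))
  ... | inj₁ a = Membership.∈-++⁺ˡ a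
  ... | inj₂ (here refl) = ⊥-elim (All.lookup x∉xs m refl)
  ... | inj₂ (there b) = Membership.∈-++⁺ʳ ys₁ b

-- Reachability and components

module _ {G : Graph} where

  adjacent? : ∀ u w → Dec (Adjacent G u w)
  adjacent? u w = Fin.any? λ e → ends≟ e (u , w) ⊎-dec ends≟ e (w , u)
    where
    ends≟ = λ e → Product.≡-dec Fin._≟_ Fin._≟_ (ends G e)

  adjacent-sym : ∀ {u w} → Adjacent G u w → Adjacent G w u
  adjacent-sym (e , inj₁ x) = e , inj₂ x
  adjacent-sym (e , inj₂ x) = e , inj₁ x

  reach-head : ∀ {S u v} → Reach G S u v → u ∈ S
  reach-head (here u∈S) = u∈S
  reach-head (step u∈S _ _) = u∈S

  reach-last : ∀ {S u v} → Reach G S u v → v ∈ S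
  reach-last (here v∈S) = v∈S
  reach-last (step _ _ r) = reach-last r

  reach-trans : ∀ {S u v w} → Reach G S u v → Reach G S v w → Reach G S u w
  reach-trans (here _) r = r
  reach-trans (step u∈S a r) r′ = step u∈S a (reach-trans r r′)

  reach-sym : ∀ {S u v} → Reach G S u v → Reach G S v u
  reach-sym (here v∈S) = here v∈S
  reach-sym (step u∈S a r) = reach-trans (reach-sym r) (step (reach-head r) (adjacent-sym a) (here u∈S))

  reach-snoc : ∀ {S u w v} → Reach G S u w → Adjacent G w v → v ∈ S → Reach G S u v
  reach-snoc r a v∈S = reach-trans r (step (reach-last r) a (here v∈S))

  reach-mono : ∀ {S S′ u v} → S ⊆ S′ → Reach G S u v → Reach G S′ u v
  reach-mono S⊆S′ (here v∈S) = here (S⊆S′ v∈S)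
  reach-mono S⊆S′ (step u∈S a r) = step (S⊆S′ u∈S) a (reach-mono S⊆S′ r)

  reach-leaves : ∀ {S u v} (A : Subset (n G)) → Reach G S u v → u ∈ A → v ∉ A →
                 ∃[ a ] ∃[ b ] (Reach G S u a × a ∈ A × b ∉ A × Adjacent G a b)
  reach-leaves A (here _) u∈A v∉A = ⊥-elim (v∉A u∈A)
  reach-leaves {u = u} A (step {w = w} u∈S a r) u∈A v∉A with w ∈? A
  ... | no w∉A = u , w , here u∈S , u∈A , w∉A , a
  ... | yes w∈A with reach-leaves A r w∈A v∉A
  ... | x , y , r′ , x∈A , y∉A , xy = x , y , step u∈S a r′ , x∈A , y∉A , xy

  module Reachability (S : Subset (n G)) (u : Fin (n G)) where

    neighbour? : ∀ (R : Fin (n G) → Bool) v → Dec (∃[ w ] (R w ≡ true × Adjacent G w v))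
    neighbour? R v = Fin.any? λ w → (R w Bool.≟ true) ×-dec adjacent? w v

    grow : (Fin (n G) → Bool) → Fin (n G) → Bool
    grow R v = R v ∨ (χ S v ∧ does (neighbour? R v))

    grow-cases : ∀ R v → grow R v ≡ true → (R v ≡ true) ⊎ (χ S v ≡ true × ∃[ w ] (R w ≡ true × Adjacent G w v))
    grow-cases R v e with ∨-true⁻ {R v} e
    ... | inj₁ Rv = inj₁ Rv
    ... | inj₂ new with ∧-true⁻ {χ S v} new
    ... | Sv , d = inj₂ (Sv , does≡true⇒ (neighbour? R v) d)

    grow-intro : ∀ R {v w} → χ S v ≡ true → R w ≡ true → Adjacent G w v → grow R v ≡ true
    grow-intro R {v} {w} Sv Rw a = trans (cong (R v ∨_) (∧-true⁺ Sv (dec-true (neighbour? R v) (w , Rw , a)))) (Bool.∨-zeroʳ (R v))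

    grow-⊇ : ∀ R v → R v ≡ true → grow R v ≡ true
    grow-⊇ R v e rewrite e = refl

    ball : ℕ → Fin (n G) → Bool
    ball zero v = χ S u ∧ does (v Fin.≟ u)
    ball (suc j) = grow (ball j)

    ball-sound : ∀ j v → ball j v ≡ true → Reach G S u v
    ball-sound zero v e with ∧-true⁻ {χ S u} e
    ... | Su , d with does≡true⇒ (v Fin.≟ u) d
    ... | refl = here (χ⇒∈ Su)
    ball-sound (suc j) v e with grow-cases (ball j) v e
    ... | inj₁ old = ball-sound j v old
    ... | inj₂ (Sv , w , Rw , a) = reach-snoc (ball-sound j w Rw) a (χ⇒∈ Sv)

    ball-⊇-centre : ∀ j → χ S u ≡ true → ball j u ≡ true
    ball-⊇-centre zero Su = ∧-true⁺ Su (dec-true (u Fin.≟ u) refl)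
    ball-⊇-centre (suc j) Su = grow-⊇ (ball j) u (ball-⊇-centre j Su)

    Closed : (Fin (n G) → Bool) → Set
    Closed R = ∀ v → grow R v ≡ true → R v ≡ true

    closed? : ∀ R → Dec (Closed R)
    closed? R = Fin.all? λ v → (grow R v Bool.≟ true) →-dec (R v Bool.≟ true)

    grow-Closed : ∀ R → Closed R → Closed (grow R)
    grow-Closed R c v e with grow-cases (grow R) v e
    ... | inj₁ old = old
    ... | inj₂ (Sv , w , Rw , a) = grow-intro R Sv (c w Rw) a

    Closed-reach : ∀ R → Closed R → ∀ {a v} → R a ≡ true → Reach G S a v → R v ≡ true
    Closed-reach R c Ra (here _) = Ra
    Closed-reach R c Ra (step _ a r) = Closed-reach R c (c _ (grow-intro R (∈⇒χ (reach-head r)) Ra a)) r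

    -- Until it stabilises, the ball gains a vertex at every step.
    ball-closed-or-big : ∀ j → Closed (ball j) ⊎ (j < count (ball j))
    ball-closed-or-big zero with true-or-false (χ S u)
    ... | inj₁ Su = inj₂ (count-pos (ball zero) u (ball-⊇-centre zero Su))
    ... | inj₂ ¬Su = inj₁ λ v e → case v (grow-cases (ball zero) v e)
      where
      case : ∀ v → (ball zero v ≡ true) ⊎ (χ S v ≡ true × ∃[ w ] (ball zero w ≡ true × Adjacent G w v)) → ball zero v ≡ true
      case v (inj₁ old) = old
      case v (inj₂ (_ , w , Rw , _)) = ⊥-elim (true≢false (trans (sym (proj₁ (∧-true⁻ {χ S u} Rw))) ¬Su))
    ball-closed-or-big (suc j) with closed? (ball j)
    ... | yes c = inj₁ (grow-Closed (ball j) c)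
    ... | no ¬c with ball-closed-or-big j
    ... | inj₁ c = ⊥-elim (¬c c)
    ... | inj₂ big with Fin.¬∀⟶∃¬ (n G) _ (λ v → (grow (ball j) v Bool.≟ true) →-dec (ball j v Bool.≟ true)) ¬c
    ... | v , ¬grown⇒old with true-or-false (ball j v) | true-or-false (grow (ball j) v)
    ... | inj₁ old | _ = ⊥-elim (¬grown⇒old (λ _ → old))
    ... | inj₂ _ | inj₂ notGrown = ⊥-elim (¬grown⇒old (λ e → ⊥-elim (true≢false (trans (sym e) notGrown))))
    ... | inj₂ notOld | inj₁ grown = inj₂ (≤-trans (s≤s big) (count-< (ball j) (ball (suc j)) (grow-⊇ (ball j)) v grown notOld))

    reachable : Fin (n G) → Bool
    reachable = ball (n G)

    reachable-closed : Closed reachable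
    reachable-closed with ball-closed-or-big (n G)
    ... | inj₁ c = c
    ... | inj₂ big = ⊥-elim (ℕ.<⇒≱ big (count≤size _))

    reachable-sound : ∀ v → reachable v ≡ true → Reach G S u v
    reachable-sound = ball-sound (n G)

    reachable-complete : ∀ {v} → Reach G S u v → reachable v ≡ true
    reachable-complete r = Closed-reach reachable reachable-closed (ball-⊇-centre (n G) (∈⇒χ (reach-head r))) r

module ComponentsOf {G : Graph} (B : Subset (n G)) where

  component : Fin (n G) → Subset (n G)
  component u = tabulate (Reachability.reachable {G = G} (∁ B) u)

  component⇒reach : ∀ {u v} → v ∈ component u → Reach G (∁ B) u v
  component⇒reach {u} {v} v∈ =
    Reachability.reachable-sound {G = G} (∁ B) u v (trans (sym (Vec.lookup∘tabulate _ v)) (∈⇒χ v∈))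

  reach⇒component : ∀ {u v} → Reach G (∁ B) u v → v ∈ component u
  reach⇒component {u} {v} r = χ⇒∈ (trans (Vec.lookup∘tabulate _ v) (Reachability.reachable-complete {G = G} (∁ B) u r))

  ∈component : ∀ {u} → u ∉ B → u ∈ component u
  ∈component u∉B = reach⇒component (here (x∉p⇒x∈∁p u∉B))

  component-IsComponent : ∀ {u} → u ∉ B → IsComponent G B (component u)
  component-IsComponent {u} u∉B =
    (u , ∈component u∉B) ,
    (λ v∈ → reach-last (component⇒reach v∈)) ,
    (λ v∈ w∈ → reach-trans (reach-sym (component⇒reach v∈)) (component⇒reach w∈)) ,
    (λ v∈ r → reach⇒component (reach-trans (component⇒reach v∈) r))

  IsComponent⇒≡component : ∀ {H u} → IsComponent G B H → u ∈ H → H ≡ component u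
  IsComponent⇒≡component {H} {u} (_ , _ , connected , closed) u∈H = subset-ext H (component u) λ v →
    bool-ext (λ e → ∈⇒χ (reach⇒component (connected u∈H (χ⇒∈ e)))) (λ e → ∈⇒χ (closed u∈H (component⇒reach (χ⇒∈ e))))

  χ-neighbour : ∀ {H v x} → IsComponent G B H → v ∈ H → Adjacent G v x → χ H x ≡ not (χ B x)
  χ-neighbour {x = x} (_ , H⊆∁B , _ , closed) v∈H vx with x ∈? B
  ... | yes x∈B rewrite ∈⇒χ x∈B = ∉⇒χ≡false (λ x∈H → x∈∁p⇒x∉p (H⊆∁B x∈H) x∈B)
  ... | no x∉B rewrite ∉⇒χ≡false x∉B = ∈⇒χ (closed v∈H (step (H⊆∁B v∈H) vx (here (x∉p⇒x∈∁p x∉B))))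

  components : List (Subset (n G))
  components = List.deduplicate (Vec.≡-dec Bool._≟_) (List.map component (filter (λ v → ¬? (v ∈? B)) (List.allFin (n G))))

  components-Components : Components G B components
  components-Components = DecUnique.deduplicate-! (Vec.≡-dec Bool._≟_) _ , λ H → mk⇔ (to H) (from H)
    where
    to : ∀ H → H ∈ₗ components → IsComponent G B H
    to H m with Membership.∈-map⁻ component (Membership.∈-deduplicate⁻ (Vec.≡-dec Bool._≟_) _ m)
    ... | v , v∈ , refl = component-IsComponent (proj₂ (Membership.∈-filter⁻ (λ v → ¬? (v ∈? B)) {xs = List.allFin (n G)} v∈))
    from : ∀ H → IsComponent G B H → H ∈ₗ components
    from H c@((v , v∈H) , H⊆∁B , _) = subst (_∈ₗ components) (sym (IsComponent⇒≡component c v∈H))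
      (Membership.∈-deduplicate⁺ (Vec.≡-dec Bool._≟_)
        (Membership.∈-map⁺ component (Membership.∈-filter⁺ (λ v → ¬? (v ∈? B)) (Membership.∈-allFin v) (x∈∁p⇒x∉p (H⊆∁B v∈H)))))

  module Listed {Hs : List (Subset (n G))} (Hs-components : Components G B Hs) where

    component∈Hs : ∀ {u} → u ∉ B → component u ∈ₗ Hs
    component∈Hs u∉B = Equivalence.from (proj₂ Hs-components _) (component-IsComponent u∉B)

    Hs⇒IsComponent : ∀ {H} → H ∈ₗ Hs → IsComponent G B H
    Hs⇒IsComponent m = Equivalence.to (proj₂ Hs-components _) m

    -- Every vertex outside B lies in exactly one listed component.
    ∑ₗ-𝟙-components : ∀ (A : Fin (n G) → Bool) v → ∑ₗ (λ H → 𝟙 (A v ∧ χ H v)) Hs ≡ 𝟙 (A v ∧ not (χ B v))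
    ∑ₗ-𝟙-components A v with A v
    ... | false = ∑ₗ-zeros _ Hs (λ _ _ → refl)
    ... | true with v ∈? B
    ... | yes v∈B =
      trans (∑ₗ-zeros _ Hs (λ H m → cong 𝟙 (∉⇒χ≡false (λ v∈H → x∈∁p⇒x∉p (proj₁ (proj₂ (Hs⇒IsComponent m)) v∈H) v∈B))))
                          (cong (λ b → 𝟙 (not b)) (sym (∈⇒χ v∈B)))
    ... | no v∉B = trans (∑ₗ-𝟙-unique (λ H → χ H v) Hs (proj₁ Hs-components) (component∈Hs v∉B) (∈⇒χ (∈component v∉B))
                           (λ H m e → IsComponent⇒≡component (Hs⇒IsComponent m) (χ⇒∈ e)))
                         (cong (λ b → 𝟙 (not b)) (sym (∉⇒χ≡false v∉B)))

    ∑ₗ-count-components : ∀ (A : Fin (n G) → Bool) → ∑ₗ (λ H → count (λ v → A v ∧ χ H v)) Hs ≡ count (λ v → A v ∧ not (χ B v))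
    ∑ₗ-count-components A = trans (∑ₗ-∑-comm (λ H v → 𝟙 (A v ∧ χ H v)) Hs) (sum-cong-≗ (∑ₗ-𝟙-components A))

-- A perfect matching as a fixed-point-free involution

module Mates {G : Graph} (M : ESet G) (M-perfect : PerfectMatching G M) where

  V : Set
  V = Fin (n G)

  end₁ end₂ : Fin (m G) → V
  end₁ e = proj₁ (ends G e)
  end₂ e = proj₂ (ends G e)

  matchedAt : V → Fin (m G) → Bool
  matchedAt v e = χ M e ∧ χ (incident G v) e

  count-matchedAt : ∀ v → count (matchedAt v) ≡ 1
  count-matchedAt v = trans (count-cong _ _ (λ e → sym (χ∩ M (incident G v) e))) (trans (sym (∣∣≡count (M ∩ incident G v))) (M-perfect v))

  χincident : ∀ v e → χ (incident G v) e ≡ (does (v Fin.≟ end₁ e) ∨ does (v Fin.≟ end₂ e))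
  χincident v e = Vec.lookup∘tabulate _ e

  incident⇒end : ∀ {v e} → χ (incident G v) e ≡ true → (v ≡ end₁ e) ⊎ (v ≡ end₂ e)
  incident⇒end {v} {e} h with ∨-true⁻ {does (v Fin.≟ end₁ e)} (trans (sym (χincident v e)) h)
  ... | inj₁ x = inj₁ (does≡true⇒ (v Fin.≟ end₁ e) x)
  ... | inj₂ y = inj₂ (does≡true⇒ (v Fin.≟ end₂ e) y)

  end⇒incident : ∀ {v e} → (v ≡ end₁ e) ⊎ (v ≡ end₂ e) → χ (incident G v) e ≡ true
  end⇒incident {v} {e} (inj₁ x) = trans (χincident v e) (cong (_∨ does (v Fin.≟ end₂ e)) (dec-true (v Fin.≟ end₁ e) x))
  end⇒incident {v} {e} (inj₂ y) =
    trans (χincident v e) (trans (cong (does (v Fin.≟ end₁ e) ∨_) (dec-true (v Fin.≟ end₂ e) y)) (Bool.∨-zeroʳ _))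

  opaque
    matched : ∀ v → Σ (Fin (m G)) (λ e → matchedAt v e ≡ true)
    matched v = count-pos⇒∃ (matchedAt v) (ℕ.≤-reflexive (sym (count-matchedAt v)))

  edgeAt : V → Fin (m G)
  edgeAt v = proj₁ (matched v)

  edgeAt-matched : ∀ v → matchedAt v (edgeAt v) ≡ true
  edgeAt-matched v = proj₂ (matched v)

  edgeAt-unique : ∀ {v e} → matchedAt v e ≡ true → e ≡ edgeAt v
  edgeAt-unique {v} {e} h with e Fin.≟ edgeAt v
  ... | yes eq = eq
  ... | no ne = ⊥-elim (ℕ.<⇒≱ (subst (1 <_) (count-matchedAt v) (count≥2 (matchedAt v) e (edgeAt v) ne h (edgeAt-matched v))) ≤-refl)

  other : V → Fin (m G) → V
  other v e = if does (v Fin.≟ end₁ e) then end₂ e else end₁ e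

  other-end₁ : ∀ {v e} → v ≡ end₁ e → other v e ≡ end₂ e
  other-end₁ {v} {e} h rewrite dec-true (v Fin.≟ end₁ e) h = refl

  other-end₂ : ∀ {v e} → v ≡ end₂ e → other v e ≡ end₁ e
  other-end₂ {v} {e} h rewrite dec-false (v Fin.≟ end₁ e) (λ x → noLoop G e (trans (sym x) h)) = refl

  matchedAt-other : ∀ {v e} → matchedAt v e ≡ true → matchedAt (other v e) e ≡ true
  matchedAt-other {v} {e} h with ∧-true⁻ {χ M e} h
  ... | e∈M , incid with incident⇒end {v} {e} incid
  ... | inj₁ x = ∧-true⁺ e∈M (end⇒incident {other v e} {e} (inj₂ (other-end₁ x)))
  ... | inj₂ y = ∧-true⁺ e∈M (end⇒incident {other v e} {e} (inj₁ (other-end₂ y)))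

  other-other : ∀ {v e} → matchedAt v e ≡ true → other (other v e) e ≡ v
  other-other {v} {e} h with incident⇒end {v} {e} (proj₂ (∧-true⁻ {χ M e} h))
  ... | inj₁ x = trans (other-end₂ (other-end₁ x)) (sym x)
  ... | inj₂ y = trans (other-end₁ (other-end₂ y)) (sym y)

  mate : V → V
  mate v = other v (edgeAt v)

  mate-via : ∀ {v e} → matchedAt v e ≡ true → mate v ≡ other v e
  mate-via {v} {e} h = cong (other v) (sym (edgeAt-unique h))

  mate-mate : ∀ v → mate (mate v) ≡ v
  mate-mate v = trans (mate-via {mate v} (matchedAt-other {v} (edgeAt-matched v))) (other-other {v} (edgeAt-matched v))

  mate-ends : ∀ v → ((v ≡ end₁ (edgeAt v)) × (mate v ≡ end₂ (edgeAt v))) ⊎ ((v ≡ end₂ (edgeAt v)) × (mate v ≡ end₁ (edgeAt v)))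
  mate-ends v with incident⇒end {v} {edgeAt v} (proj₂ (∧-true⁻ {χ M (edgeAt v)} (edgeAt-matched v)))
  ... | inj₁ x = inj₁ (x , other-end₁ x)
  ... | inj₂ y = inj₂ (y , other-end₂ y)

  mate≢ : ∀ v → mate v ≢ v
  mate≢ v eq with mate-ends v
  ... | inj₁ (a , b) = noLoop G (edgeAt v) (trans (sym a) (trans (sym eq) b))
  ... | inj₂ (a , b) = noLoop G (edgeAt v) (trans (sym b) (trans eq a))

  mate-adjacent : ∀ v → Adjacent G v (mate v)
  mate-adjacent v with mate-ends v
  ... | inj₁ (a , b) = edgeAt v , inj₁ (cong₂ _,_ (sym a) (sym b))
  ... | inj₂ (a , b) = edgeAt v , inj₂ (cong₂ _,_ (sym b) (sym a))

  mate-of-edge : ∀ {e u w} → e ∈ M → (ends G e ≡ (u , w)) ⊎ (ends G e ≡ (w , u)) → mate u ≡ w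
  mate-of-edge {e} {u} e∈M (inj₁ eq) =
    trans (mate-via (∧-true⁺ (∈⇒χ e∈M) (end⇒incident {u} {e} (inj₁ (sym (cong proj₁ eq))))))
          (trans (other-end₁ (sym (cong proj₁ eq))) (cong proj₂ eq))
  mate-of-edge {e} {u} e∈M (inj₂ eq) =
    trans (mate-via (∧-true⁺ (∈⇒χ e∈M) (end⇒incident {u} {e} (inj₂ (sym (cong proj₂ eq))))))
          (trans (other-end₂ (sym (cong proj₂ eq))) (cong proj₁ eq))

  count-mate : (f : V → Bool) → count (f ∘ mate) ≡ count f
  count-mate = count-involution mate mate-mate

  -- Within each matched pair inside A, exactly one vertex is the smaller one.
  count-matched-within-even : ∀ (A : V → Bool) → ∃[ t ] (count (λ v → A v ∧ A (mate v)) ≡ t + t)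
  count-matched-within-even A = count (λ v → Q v ∧ lower v) , trans (count-split Q lower) (cong (count (λ v → Q v ∧ lower v) +_) upper≡lower)
    where
    Q : V → Bool
    Q v = A v ∧ A (mate v)
    lower : V → Bool
    lower v = does (v Fin.<? mate v)
    <?-flip : ∀ {a b : V} → a ≢ b → does (b Fin.<? a) ≡ not (does (a Fin.<? b))
    <?-flip {a} {b} a≢b with Fin.<-cmp a b
    ... | tri< a<b _ b≮a = trans (dec-false (b Fin.<? a) b≮a) (cong not (sym (dec-true (a Fin.<? b) a<b)))
    ... | tri≈ _ a≡b _ = ⊥-elim (a≢b a≡b)
    ... | tri> a≮b _ b<a = trans (dec-true (b Fin.<? a) b<a) (cong not (sym (dec-false (a Fin.<? b) a≮b)))
    flip : ∀ v → Q v ∧ not (lower v) ≡ Q (mate v) ∧ lower (mate v)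
    flip v = sym (cong₂ _∧_ (trans (cong (A (mate v) ∧_) (cong A (mate-mate v))) (Bool.∧-comm (A (mate v)) (A v)))
                            (trans (cong (λ w → does (mate v Fin.<? w)) (mate-mate v)) (<?-flip (mate≢ v ∘ sym))))
    upper≡lower : count (λ v → Q v ∧ not (lower v)) ≡ count (λ v → Q v ∧ lower v)
    upper≡lower = trans (count-cong _ _ flip) (count-mate (λ v → Q v ∧ lower v))

  oddᵇ-count≡oddᵇ-leaving : ∀ (A : V → Bool) → oddᵇ (count A) ≡ oddᵇ (count (λ v → A v ∧ not (A (mate v))))
  oddᵇ-count≡oddᵇ-leaving A with count-matched-within-even A
  ... | t , within≡2t = begin
    oddᵇ (count A)                                                ≡⟨ cong oddᵇ (count-split A (A ∘ mate)) ⟩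
    oddᵇ (count (λ v → A v ∧ A (mate v)) + count leaving)         ≡⟨ oddᵇ-+ (count (λ v → A v ∧ A (mate v))) (count leaving) ⟩
    oddᵇ (count (λ v → A v ∧ A (mate v))) xor oddᵇ (count leaving)
      ≡⟨ cong (_xor oddᵇ (count leaving)) (trans (cong oddᵇ within≡2t) (oddᵇ-double t)) ⟩
    oddᵇ (count leaving) ∎
    where
    open ≡-Reasoning
    leaving : V → Bool
    leaving v = A v ∧ not (A (mate v))

  oddᵇ-n≡false : oddᵇ (n G) ≡ false
  oddᵇ-n≡false = begin
    oddᵇ (n G)                          ≡⟨ cong oddᵇ (sym (count-true {n G})) ⟩
    oddᵇ (count {n G} (λ _ → true))     ≡⟨ oddᵇ-count≡oddᵇ-leaving (λ _ → true) ⟩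
    oddᵇ (count {n G} (λ _ → false))    ≡⟨ cong oddᵇ (count-none {n G} (λ _ → false) (λ _ → refl)) ⟩
    false ∎
    where open ≡-Reasoning

  χ∂ : ∀ (X : Subset (n G)) e → χ (∂ G X) e ≡ (χ X (end₁ e) xor χ X (end₂ e))
  χ∂ X e = Vec.lookup∘tabulate _ e

  -- Double counting the pairs (v, e) with e ∈ M ∩ ∂X incident with v ∈ X.
  module _ (X : Subset (n G)) where

    private
      incidence : V → Fin (m G) → ℕ
      incidence v e = 𝟙 (matchedAt v e ∧ (χ (∂ G X) e ∧ χ X v))

    incidence-at-vertex : ∀ v → sum (incidence v) ≡ 𝟙 (χ X v ∧ not (χ X (mate v)))
    incidence-at-vertex v = trans (sum-single _ (edgeAt v) off-edge)
      (trans (cong (λ b → 𝟙 (b ∧ (χ (∂ G X) (edgeAt v) ∧ χ X v))) (edgeAt-matched v)) (cong 𝟙 at-edge))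
      where
      off-edge : ∀ e → e ≢ edgeAt v → incidence v e ≡ 0
      off-edge e ne with true-or-false (matchedAt v e)
      ... | inj₁ t = ⊥-elim (ne (edgeAt-unique t))
      ... | inj₂ f = cong (λ b → 𝟙 (b ∧ (χ (∂ G X) e ∧ χ X v))) f
      xor-∧ˡ : ∀ x y → (x xor y) ∧ x ≡ x ∧ not y
      xor-∧ˡ true y = Bool.∧-identityʳ (not y)
      xor-∧ˡ false y = Bool.∧-zeroʳ y
      xor-∧ʳ : ∀ x y → (y xor x) ∧ x ≡ x ∧ not y
      xor-∧ʳ true true = refl
      xor-∧ʳ true false = refl
      xor-∧ʳ false y = Bool.∧-zeroʳ _
      at-edge : χ (∂ G X) (edgeAt v) ∧ χ X v ≡ χ X v ∧ not (χ X (mate v))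
      at-edge with mate-ends v
      ... | inj₁ (a , b) = trans (cong (_∧ χ X v) (trans (χ∂ X (edgeAt v)) (cong₂ _xor_ (cong (χ X) (sym a)) (cong (χ X) (sym b)))))
                                 (xor-∧ˡ (χ X v) (χ X (mate v)))
      ... | inj₂ (a , b) = trans (cong (_∧ χ X v) (trans (χ∂ X (edgeAt v)) (cong₂ _xor_ (cong (χ X) (sym b)) (cong (χ X) (sym a)))))
                                 (xor-∧ʳ (χ X v) (χ X (mate v)))

    incidence-at-edge : ∀ e → sum (λ v → incidence v e) ≡ 𝟙 (χ (∂ G X) e ∧ χ M e)
    incidence-at-edge e with true-or-false (χ M e)
    ... | inj₂ e∉M = trans (sum-zeros _ (λ v → cong (λ b → 𝟙 ((b ∧ χ (incident G v) e) ∧ (χ (∂ G X) e ∧ χ X v))) e∉M))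
                           (sym (cong 𝟙 (trans (cong (χ (∂ G X) e ∧_) e∉M) (Bool.∧-zeroʳ _))))
    ... | inj₁ e∈M = begin
        sum (λ v → incidence v e)
          ≡⟨ sum-cong-≗ (λ v → cong (λ b → 𝟙 ((b ∧ χ (incident G v) e) ∧ Q v)) e∈M) ⟩
        sum (λ v → 𝟙 (χ (incident G v) e ∧ Q v))
          ≡⟨ sum-cong-≗ (λ v → trans (cong (λ b → 𝟙 (b ∧ Q v)) (χincident v e)) (𝟙-∨-disjoint _ _ (Q v) (end₁⇒¬end₂ v))) ⟩
        sum (λ v → 𝟙 (does (v Fin.≟ end₁ e) ∧ Q v) + 𝟙 (does (v Fin.≟ end₂ e) ∧ Q v))
          ≡⟨ ∑-distrib-+ (λ v → 𝟙 (does (v Fin.≟ end₁ e) ∧ Q v)) (λ v → 𝟙 (does (v Fin.≟ end₂ e) ∧ Q v)) ⟩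
        count (λ v → does (v Fin.≟ end₁ e) ∧ Q v) + count (λ v → does (v Fin.≟ end₂ e) ∧ Q v)
          ≡⟨ cong₂ _+_ (count-single Q (end₁ e)) (count-single Q (end₂ e)) ⟩
        𝟙 (Q (end₁ e)) + 𝟙 (Q (end₂ e))
          ≡⟨ cong₂ (λ c d → 𝟙 (c ∧ χ X (end₁ e)) + 𝟙 (d ∧ χ X (end₂ e))) (χ∂ X e) (χ∂ X e) ⟩
        𝟙 ((χ X (end₁ e) xor χ X (end₂ e)) ∧ χ X (end₁ e)) + 𝟙 ((χ X (end₁ e) xor χ X (end₂ e)) ∧ χ X (end₂ e))
          ≡⟨ one-end-in-X (χ X (end₁ e)) (χ X (end₂ e)) ⟩
        𝟙 (χ X (end₁ e) xor χ X (end₂ e))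
          ≡⟨ cong (λ c → 𝟙 c) (trans (sym (χ∂ X e)) (sym (Bool.∧-identityʳ _))) ⟩
        𝟙 (χ (∂ G X) e ∧ true) ≡⟨ cong (λ c → 𝟙 (χ (∂ G X) e ∧ c)) (sym e∈M) ⟩
        𝟙 (χ (∂ G X) e ∧ χ M e) ∎
      where
      open ≡-Reasoning
      Q : V → Bool
      Q v = χ (∂ G X) e ∧ χ X v
      end₁⇒¬end₂ : ∀ v → does (v Fin.≟ end₁ e) ≡ true → does (v Fin.≟ end₂ e) ≡ false
      end₁⇒¬end₂ v t = dec-false (v Fin.≟ end₂ e) (λ q → noLoop G e (trans (sym (does≡true⇒ (v Fin.≟ end₁ e) t)) q))
      𝟙-∨-disjoint : ∀ x y q → (x ≡ true → y ≡ false) → 𝟙 ((x ∨ y) ∧ q) ≡ 𝟙 (x ∧ q) + 𝟙 (y ∧ q)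
      𝟙-∨-disjoint true y q h rewrite h refl = sym (ℕ.+-identityʳ _)
      𝟙-∨-disjoint false y q h = refl
      one-end-in-X : ∀ a b → 𝟙 ((a xor b) ∧ a) + 𝟙 ((a xor b) ∧ b) ≡ 𝟙 (a xor b)
      one-end-in-X true true = refl
      one-end-in-X true false = refl
      one-end-in-X false true = refl
      one-end-in-X false false = refl

    count-leaving≡∣∂∩M∣ : count (λ v → χ X v ∧ not (χ X (mate v))) ≡ ∣ ∂ G X ∩ M ∣
    count-leaving≡∣∂∩M∣ = begin
        count (λ v → χ X v ∧ not (χ X (mate v))) ≡⟨ sum-cong-≗ (sym ∘ incidence-at-vertex) ⟩
        sum (λ v → sum (incidence v))            ≡⟨ ∑-comm incidence ⟩
        sum (λ e → sum (λ v → incidence v e))    ≡⟨ sum-cong-≗ incidence-at-edge ⟩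
        count (λ e → χ (∂ G X) e ∧ χ M e)        ≡⟨ sym (∣∩∣≡count (∂ G X) M) ⟩
        ∣ ∂ G X ∩ M ∣ ∎
      where open ≡-Reasoning

edge-in-perfect-matching : ∀ {G} → MatchingCovered G → ∀ {u w} → Adjacent G u w →
                           ∃[ M ] Σ (PerfectMatching G M) λ M-perfect → Mates.mate {G = G} M M-perfect u ≡ w
edge-in-perfect-matching {G} G-mc (e , ends≡) with proj₂ (proj₂ G-mc) e
... | M , M-perfect , e∈M = M , M-perfect , Mates.mate-of-edge {G = G} M M-perfect e∈M ends≡

-- Odd components against a perfect matching

#odd≡∑ₗ : ∀ {k} (L : List (Subset k)) → length (oddOnes L) ≡ ∑ₗ (λ H → 𝟙 (oddᵇ ∣ H ∣)) L
#odd≡∑ₗ L = trans (length-filter (λ H → isOdd? ∣ H ∣) L) (∑ₗ-cong _ _ L (λ H _ → cong 𝟙 (does-isOdd? ∣ H ∣)))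

#oddIn≡∑ₗ : ∀ {k} (Z : Subset k) (L : List (Subset k)) → length (oddIn Z L) ≡ ∑ₗ (λ H → 𝟙 (oddᵇ ∣ H ∩ Z ∣)) L
#oddIn≡∑ₗ Z L = trans (length-filter (λ H → isOdd? ∣ H ∩ Z ∣) L) (∑ₗ-cong _ _ L (λ H _ → cong 𝟙 (does-isOdd? ∣ H ∩ Z ∣)))

#odd-≤ : ∀ {G : Graph} {S : Subset (n G)} {L₁ L₂} → Components G S L₁ → Components G S L₂ → length (oddOnes L₁) ≤ length (oddOnes L₂)
#odd-≤ {L₁ = L₁} L₁-components L₂-components =
  Unique⇒length-≤ _ _ (Unique.filter⁺ _ (proj₁ L₁-components)) λ H H∈ →
    let H∈L₁ , odd = Membership.∈-filter⁻ (λ S → isOdd? ∣ S ∣) {xs = L₁} H∈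
    in Membership.∈-filter⁺ (λ S → isOdd? ∣ S ∣)
         (Equivalence.from (proj₂ L₂-components H) (Equivalence.to (proj₂ L₁-components H) H∈L₁)) odd

module MatchedInto {G : Graph} (S : Subset (n G)) {L : List (Subset (n G))} (L-components : Components G S L)
                   (M : ESet G) (M-perfect : PerfectMatching G M) where
  open Mates {G = G} M M-perfect
  open ComponentsOf {G = G} S
  open Listed L-components

  matchedIntoS : Subset (n G) → ℕ
  matchedIntoS H = count (λ v → χ S (mate v) ∧ χ H v)

  withinS intoS : V → Bool
  withinS v = χ S v ∧ χ S (mate v)
  intoS v = χ S (mate v) ∧ not (χ S v)

  ∣S∣≡withinS+intoS : ∣ S ∣ ≡ count withinS + count intoS
  ∣S∣≡withinS+intoS = trans (∣∣≡count S) (trans (count-split (χ S) (χ S ∘ mate)) (cong (count withinS +_)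
    (trans (sym (count-mate (λ v → χ S v ∧ not (χ S (mate v))))) (count-cong _ _ λ v → cong (λ w → χ S (mate v) ∧ not (χ S w)) (mate-mate v)))))

  ∑ₗmatchedIntoS≡intoS : ∑ₗ matchedIntoS L ≡ count intoS
  ∑ₗmatchedIntoS≡intoS = ∑ₗ-count-components (χ S ∘ mate)

  -- A vertex of a component is matched out of it exactly when it is matched into S.
  oddᵇ-matchedIntoS : ∀ {H} → H ∈ₗ L → oddᵇ (matchedIntoS H) ≡ oddᵇ ∣ H ∣
  oddᵇ-matchedIntoS {H} H∈L =
    sym (trans (cong oddᵇ (∣∣≡count H)) (trans (oddᵇ-count≡oddᵇ-leaving (χ H)) (cong oddᵇ (count-cong _ _ leaving⇔intoS))))
    where
    leaving⇔intoS : ∀ v → χ H v ∧ not (χ H (mate v)) ≡ χ S (mate v) ∧ χ H v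
    leaving⇔intoS v with true-or-false (χ H v)
    ... | inj₂ v∉H rewrite v∉H = sym (Bool.∧-zeroʳ _)
    ... | inj₁ v∈H rewrite v∈H | χ-neighbour (Hs⇒IsComponent H∈L) (χ⇒∈ v∈H) (mate-adjacent v) =
      trans (Bool.not-involutive _) (sym (Bool.∧-identityʳ _))

  odd≤matchedIntoS : ∀ {H} → H ∈ₗ L → 𝟙 (oddᵇ ∣ H ∣) ≤ matchedIntoS H
  odd≤matchedIntoS {H} H∈L with true-or-false (oddᵇ ∣ H ∣)
  ... | inj₂ even rewrite even = z≤n
  ... | inj₁ odd rewrite odd with matchedIntoS H in e
  ... | zero = ⊥-elim (true≢false (trans (sym odd) (trans (sym (oddᵇ-matchedIntoS H∈L)) (cong oddᵇ e))))
  ... | suc _ = s≤s z≤n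

  ∑ₗodd≤∑ₗmatchedIntoS : ∑ₗ (λ H → 𝟙 (oddᵇ ∣ H ∣)) L ≤ ∑ₗ matchedIntoS L
  ∑ₗodd≤∑ₗmatchedIntoS = ∑ₗ-mono _ _ L (λ H → odd≤matchedIntoS)

  ∑ₗmatchedIntoS≤∣S∣ : ∑ₗ matchedIntoS L ≤ ∣ S ∣
  ∑ₗmatchedIntoS≤∣S∣ = begin
    ∑ₗ matchedIntoS L           ≡⟨ ∑ₗmatchedIntoS≡intoS ⟩
    count intoS                 ≤⟨ ℕ.m≤n+m _ _ ⟩
    count withinS + count intoS ≡⟨ sym ∣S∣≡withinS+intoS ⟩
    ∣ S ∣ ∎
    where open ≤-Reasoning

  #odd≤∣S∣ : length (oddOnes L) ≤ ∣ S ∣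
  #odd≤∣S∣ = ≤-trans (ℕ.≤-reflexive (#odd≡∑ₗ L)) (≤-trans ∑ₗodd≤∑ₗmatchedIntoS ∑ₗmatchedIntoS≤∣S∣)

  oddᵇ-#odd≡oddᵇ-∣S∣ : oddᵇ (length (oddOnes L)) ≡ oddᵇ ∣ S ∣
  oddᵇ-#odd≡oddᵇ-∣S∣ = begin
    oddᵇ (length (oddOnes L))              ≡⟨ cong oddᵇ (#odd≡∑ₗ L) ⟩
    oddᵇ (∑ₗ (λ H → 𝟙 (oddᵇ ∣ H ∣)) L)     ≡⟨ sym (oddᵇ-∑ₗ ∣_∣ L) ⟩
    oddᵇ (∑ₗ ∣_∣ L)
      ≡⟨ cong oddᵇ (trans (∑ₗ-cong _ _ L (λ H _ → ∣∣≡count H)) (∑ₗ-count-components (λ _ → true))) ⟩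
    oddᵇ (count (not ∘ χ S))                ≡⟨ xor≡false⇒≡ (oddᵇ ∣ S ∣) _ ∣S∣+∣∁S∣-even ⟩
    oddᵇ ∣ S ∣ ∎
    where
    open ≡-Reasoning
    xor≡false⇒≡ : ∀ a b → a xor b ≡ false → b ≡ a
    xor≡false⇒≡ true true _ = refl
    xor≡false⇒≡ false false _ = refl
    ∣S∣+∣∁S∣-even : oddᵇ ∣ S ∣ xor oddᵇ (count (not ∘ χ S)) ≡ false
    ∣S∣+∣∁S∣-even = begin
      oddᵇ ∣ S ∣ xor oddᵇ (count (not ∘ χ S))  ≡⟨ sym (oddᵇ-+ ∣ S ∣ _) ⟩
      oddᵇ (∣ S ∣ + count (not ∘ χ S))        ≡⟨ cong (λ s → oddᵇ (s + count (not ∘ χ S))) (∣∣≡count S) ⟩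
      oddᵇ (count (χ S) + count (not ∘ χ S))  ≡⟨ cong oddᵇ (trans (sym (count-split (λ _ → true) (χ S))) (count-true {n G})) ⟩
      oddᵇ (n G)                               ≡⟨ oddᵇ-n≡false ⟩
      false ∎

  -- When o(G - S) = |S| all the inequalities above are tight.
  module WhenBarrier (#odd≡∣S∣ : length (oddOnes L) ≡ ∣ S ∣) where

    ∑ₗodd≡∑ₗmatchedIntoS : ∑ₗ (λ H → 𝟙 (oddᵇ ∣ H ∣)) L ≡ ∑ₗ matchedIntoS L
    ∑ₗodd≡∑ₗmatchedIntoS = ℕ.≤-antisym ∑ₗodd≤∑ₗmatchedIntoS
      (≤-trans ∑ₗmatchedIntoS≤∣S∣ (ℕ.≤-reflexive (trans (sym #odd≡∣S∣) (#odd≡∑ₗ L))))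

    matchedIntoS≡odd : ∀ {H} → H ∈ₗ L → matchedIntoS H ≡ 𝟙 (oddᵇ ∣ H ∣)
    matchedIntoS≡odd {H} H∈L = sym (∑ₗ-≤-≡⇒≡ _ _ L (λ H → odd≤matchedIntoS) ∑ₗodd≡∑ₗmatchedIntoS H H∈L)

    count-withinS≡0 : count withinS ≡ 0
    count-withinS≡0 = ℕ.+-cancelʳ-≡ (count intoS) (count withinS) 0
      (trans (sym ∣S∣≡withinS+intoS) (trans (sym #odd≡∣S∣) (trans (#odd≡∑ₗ L) (trans ∑ₗodd≡∑ₗmatchedIntoS ∑ₗmatchedIntoS≡intoS))))

    mate-∉S : ∀ v → χ S v ≡ true → χ S (mate v) ≡ false
    mate-∉S v v∈S with true-or-false (χ S (mate v))
    ... | inj₂ f = f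
    ... | inj₁ t = ⊥-elim (ℕ.<⇒≱ (subst (0 <_) count-withinS≡0 (count-pos withinS v (∧-true⁺ v∈S t))) ≤-refl)

-- A barrier across a tight cut

module MatchingCoveredBarrier (G : Graph) (G-mc : MatchingCovered G)
                              (B : Subset (n G)) (B-barrier : Barrier G B) {Hs : List (Subset (n G))} (Hs-components : Components G B Hs) where
  open ComponentsOf {G = G} B
  open Listed Hs-components

  #odd≡∣B∣ : length (oddOnes Hs) ≡ ∣ B ∣
  #odd≡∣B∣ = trans (ℕ.≤-antisym (#odd-≤ Hs-components L-components) (#odd-≤ L-components Hs-components)) (proj₂ (proj₂ (proj₂ B-barrier)))
    where
    L-components = proj₁ (proj₂ (proj₂ B-barrier))

  -- An even component has no vertex matched into B by any perfect matching, yet G is connected and every edge is matchable.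
  components-odd : ∀ {H} → H ∈ₗ Hs → oddᵇ ∣ H ∣ ≡ true
  components-odd {H} H∈Hs with true-or-false (oddᵇ ∣ H ∣)
  ... | inj₁ odd = odd
  ... | inj₂ even with Hs⇒IsComponent H∈Hs | proj₁ B-barrier
  ... | (u , u∈H) , H⊆∁B , _ , closed | b , b∈B with reach-leaves H (proj₁ G-mc u b) u∈H (λ b∈H → x∈∁p⇒x∉p (H⊆∁B b∈H) b∈B)
  ... | x , y , _ , x∈H , y∉H , xy with y ∈? B
  ... | no y∉B = ⊥-elim (y∉H (closed x∈H (step (H⊆∁B x∈H) xy (here (x∉p⇒x∈∁p y∉B)))))
  ... | yes y∈B with edge-in-perfect-matching G-mc xy
  ... | M , M-perfect , mate-x≡y = ⊥-elim (ℕ.<⇒≱ (subst (0 <_) none-counted x-counted) ≤-refl)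
    where
    open Mates {G = G} M M-perfect
    open MatchedInto {G = G} B Hs-components M M-perfect
    x-counted : 1 ≤ matchedIntoS H
    x-counted = count-pos _ x (∧-true⁺ (subst (λ z → χ B z ≡ true) (sym mate-x≡y) (∈⇒χ y∈B)) (∈⇒χ x∈H))
    none-counted : matchedIntoS H ≡ 0
    none-counted = trans (WhenBarrier.matchedIntoS≡odd #odd≡∣B∣ H∈Hs) (cong 𝟙 even)

  module AcrossTightCut (X : Subset (n G)) (X-tight : Tight G (∂ G X)) where

    oddInX oddIn∁X : Subset (n G) → ℕ
    oddInX H = 𝟙 (oddᵇ ∣ H ∩ X ∣)
    oddIn∁X H = 𝟙 (oddᵇ ∣ H ∩ ∁ X ∣)

    oddInX+oddIn∁X≡1 : ∀ {H} → H ∈ₗ Hs → oddInX H + oddIn∁X H ≡ 1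
    oddInX+oddIn∁X≡1 {H} H∈Hs = exactly-one (oddᵇ ∣ H ∩ X ∣) (oddᵇ ∣ H ∩ ∁ X ∣)
      (trans (sym (oddᵇ-+ ∣ H ∩ X ∣ ∣ H ∩ ∁ X ∣)) (trans (cong oddᵇ (sym (∣∣≡∣∩∣+∣∩∁∣ H X))) (components-odd H∈Hs)))
      where
      exactly-one : ∀ a b → a xor b ≡ true → 𝟙 a + 𝟙 b ≡ 1
      exactly-one true false _ = refl
      exactly-one false true _ = refl

    ∣B∣≡#oddInX+#oddIn∁X : ∣ B ∣ ≡ length (oddIn X Hs) + length (oddIn (∁ X) Hs)
    ∣B∣≡#oddInX+#oddIn∁X = begin
      ∣ B ∣                                        ≡⟨ sym #odd≡∣B∣ ⟩
      length (oddOnes Hs)                          ≡⟨ #odd≡∑ₗ Hs ⟩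
      ∑ₗ (λ H → 𝟙 (oddᵇ ∣ H ∣)) Hs
        ≡⟨ ∑ₗ-cong _ _ Hs (λ H H∈Hs → trans (cong 𝟙 (components-odd H∈Hs)) (sym (oddInX+oddIn∁X≡1 H∈Hs))) ⟩
      ∑ₗ (λ H → oddInX H + oddIn∁X H) Hs           ≡⟨ ∑ₗ-distrib-+ oddInX oddIn∁X Hs ⟩
      ∑ₗ oddInX Hs + ∑ₗ oddIn∁X Hs                 ≡⟨ sym (cong₂ _+_ (#oddIn≡∑ₗ X Hs) (#oddIn≡∑ₗ (∁ X) Hs)) ⟩
      length (oddIn X Hs) + length (oddIn (∁ X) Hs) ∎
      where open ≡-Reasoning

    module UnderMatching (M : ESet G) (M-perfect : PerfectMatching G M) where
      open Mates {G = G} M M-perfect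
      open MatchedInto {G = G} B Hs-components M M-perfect
      open WhenBarrier #odd≡∣B∣

      leavesX : V → Bool
      leavesX v = χ X v ∧ not (χ X (mate v))

      toB∩X leavesXAt toB∩XFrom∁X cutEdgesAt : Subset (n G) → ℕ
      toB∩X H = count (λ v → χ (B ∩ X) (mate v) ∧ χ H v)
      leavesXAt H = count (λ v → leavesX v ∧ χ H v)
      toB∩XFrom∁X H = count (λ v → (χ (B ∩ X) (mate v) ∧ not (χ X v)) ∧ χ H v)
      -- The edges of M ∩ ∂X meeting H: either at H ∩ X, or at H - X with the other end in B ∩ X.
      cutEdgesAt H = leavesXAt H + toB∩XFrom∁X H

      ∑ₗtoB∩X≡∣B∩X∣ : ∑ₗ toB∩X Hs ≡ ∣ B ∩ X ∣
      ∑ₗtoB∩X≡∣B∩X∣ = begin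
          ∑ₗ toB∩X Hs                                          ≡⟨ ∑ₗ-count-components (λ v → χ (B ∩ X) (mate v)) ⟩
          count (λ v → χ (B ∩ X) (mate v) ∧ not (χ B v))
            ≡⟨ count-cong _ _ (λ v → cong (λ w → χ (B ∩ X) (mate v) ∧ not (χ B w)) (sym (mate-mate v))) ⟩
          count (matedOutOfB ∘ mate)                            ≡⟨ count-mate matedOutOfB ⟩
          count matedOutOfB                                     ≡⟨ count-cong _ _ B∩X-matedOutOfB ⟩
          count (χ (B ∩ X))                                     ≡⟨ sym (∣∣≡count (B ∩ X)) ⟩
          ∣ B ∩ X ∣ ∎
        where
        open ≡-Reasoning
        matedOutOfB : V → Bool
        matedOutOfB v = χ (B ∩ X) v ∧ not (χ B (mate v))
        B∩X-matedOutOfB : ∀ v → matedOutOfB v ≡ χ (B ∩ X) v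
        B∩X-matedOutOfB v with true-or-false (χ (B ∩ X) v)
        ... | inj₂ e = trans (cong (_∧ not (χ B (mate v))) e) (sym e)
        ... | inj₁ e = trans (cong₂ (λ a b → a ∧ not b) e (mate-∉S v (∈⇒χ (proj₁ (x∈p∩q⁻ B X (χ⇒∈ e)))))) (sym e)

      ∑ₗcutEdgesAt≡1 : ∑ₗ cutEdgesAt Hs ≡ 1
      ∑ₗcutEdgesAt≡1 = begin
          ∑ₗ cutEdgesAt Hs                                 ≡⟨ ∑ₗ-distrib-+ leavesXAt toB∩XFrom∁X Hs ⟩
          ∑ₗ leavesXAt Hs + ∑ₗ toB∩XFrom∁X Hs
            ≡⟨ cong₂ _+_ (∑ₗ-count-components leavesX) (∑ₗ-count-components (λ v → χ (B ∩ X) (mate v) ∧ not (χ X v))) ⟩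
          count (λ v → leavesX v ∧ not (χ B v)) + _        ≡⟨ cong (count (λ v → leavesX v ∧ not (χ B v)) +_) from∁X≡fromB ⟩
          count (λ v → leavesX v ∧ not (χ B v)) + count leavesXFromB ≡⟨ +-comm (count (λ v → leavesX v ∧ not (χ B v))) _ ⟩
          count leavesXFromB + count (λ v → leavesX v ∧ not (χ B v)) ≡⟨ sym (count-split leavesX (χ B)) ⟩
          count leavesX                                    ≡⟨ count-leaving≡∣∂∩M∣ X ⟩
          ∣ ∂ G X ∩ M ∣                                     ≡⟨ X-tight M M-perfect ⟩
          1 ∎
        where
        open ≡-Reasoning
        leavesXFromB : V → Bool
        leavesXFromB v = leavesX v ∧ χ B v
        mate-of-B-outside-B : ∀ b x x′ b′ → (b ≡ true → b′ ≡ false) → ((b ∧ x) ∧ not x′) ∧ not b′ ≡ (x ∧ not x′) ∧ b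
        mate-of-B-outside-B true x x′ b′ k rewrite k refl = refl
        mate-of-B-outside-B false x x′ b′ k = sym (Bool.∧-zeroʳ _)
        flip : ∀ v → (χ (B ∩ X) (mate v) ∧ not (χ X v)) ∧ not (χ B v) ≡ leavesXFromB (mate v)
        flip v = trans (cong (λ c → (c ∧ not (χ X v)) ∧ not (χ B v)) (χ∩ B X (mate v)))
                 (trans (mate-of-B-outside-B (χ B (mate v)) (χ X (mate v)) (χ X v) (χ B v)
                          (λ e → subst (λ w → χ B w ≡ false) (mate-mate v) (mate-∉S (mate v) e)))
                        (cong (λ w → (χ X (mate v) ∧ not (χ X w)) ∧ χ B (mate v)) (sym (mate-mate v))))
        from∁X≡fromB : count (λ v → (χ (B ∩ X) (mate v) ∧ not (χ X v)) ∧ not (χ B v)) ≡ count leavesXFromB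
        from∁X≡fromB = trans (count-cong _ _ flip) (count-mate leavesXFromB)

      toB∩XInX : Subset (n G) → ℕ
      toB∩XInX H = count (λ v → (χ (B ∩ X) (mate v) ∧ χ X v) ∧ χ H v)

      toB∩X≡InX+From∁X : ∀ H → toB∩X H ≡ toB∩XInX H + toB∩XFrom∁X H
      toB∩X≡InX+From∁X H = trans (count-split (λ v → χ (B ∩ X) (mate v) ∧ χ H v) (χ X))
        (cong₂ _+_ (count-cong _ _ (λ v → swap (χ (B ∩ X) (mate v)) (χ H v) (χ X v)))
                   (count-cong _ _ (λ v → swap (χ (B ∩ X) (mate v)) (χ H v) (not (χ X v)))))
        where
        swap : ∀ a h x → (a ∧ h) ∧ x ≡ (a ∧ x) ∧ h
        swap a h x rewrite Bool.∧-assoc a h x | Bool.∧-comm h x = sym (Bool.∧-assoc a x h)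

      -- A vertex of H ∩ X is matched out of H ∩ X either across ∂X or, inside X, into B.
      leaving-H∩X : ∀ {H} → H ∈ₗ Hs → count (λ v → (χ H v ∧ χ X v) ∧ not (χ H (mate v) ∧ χ X (mate v))) ≡ leavesXAt H + toB∩XInX H
      leaving-H∩X {H} H∈Hs = trans (sum-cong-≗ λ v → split (χ H v) (χ X v) (χ H (mate v)) (χ X (mate v)) (χ B (mate v)) (mate∈H⇔∉B v))
        (trans (∑-distrib-+ (λ v → 𝟙 (leavesX v ∧ χ H v)) (λ v → 𝟙 (((χ B (mate v) ∧ χ X (mate v)) ∧ χ X v) ∧ χ H v)))
               (cong (leavesXAt H +_) (count-cong _ _ λ v → cong (λ c → (c ∧ χ X v) ∧ χ H v) (sym (χ∩ B X (mate v))))))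
        where
        mate∈H⇔∉B : ∀ v → χ H v ≡ true → χ H (mate v) ≡ not (χ B (mate v))
        mate∈H⇔∉B v v∈H = χ-neighbour (Hs⇒IsComponent H∈Hs) (χ⇒∈ v∈H) (mate-adjacent v)
        split : ∀ h x h′ x′ b′ → (h ≡ true → h′ ≡ not b′) →
                𝟙 ((h ∧ x) ∧ not (h′ ∧ x′)) ≡ 𝟙 ((x ∧ not x′) ∧ h) + 𝟙 (((b′ ∧ x′) ∧ x) ∧ h)
        split false x h′ x′ b′ _ rewrite Bool.∧-zeroʳ (x ∧ not x′) | Bool.∧-zeroʳ ((b′ ∧ x′) ∧ x) = refl
        split true x h′ x′ b′ k rewrite k refl with x | x′ | b′
        ... | true | true | true = refl
        ... | true | true | false = refl
        ... | true | false | true = refl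
        ... | true | false | false = refl
        ... | false | true | true = refl
        ... | false | true | false = refl
        ... | false | false | true = refl
        ... | false | false | false = refl

      oddᵇ-∣H∩X∣ : ∀ {H} → H ∈ₗ Hs → oddᵇ ∣ H ∩ X ∣ ≡ oddᵇ (cutEdgesAt H + toB∩X H)
      oddᵇ-∣H∩X∣ {H} H∈Hs = begin
          oddᵇ ∣ H ∩ X ∣                                   ≡⟨ cong oddᵇ (∣∩∣≡count H X) ⟩
          oddᵇ (count (λ v → χ H v ∧ χ X v))               ≡⟨ oddᵇ-count≡oddᵇ-leaving (λ v → χ H v ∧ χ X v) ⟩
          oddᵇ (count (λ v → (χ H v ∧ χ X v) ∧ not (χ H (mate v) ∧ χ X (mate v))))
                                                           ≡⟨ cong oddᵇ (leaving-H∩X H∈Hs) ⟩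
          oddᵇ (leavesXAt H + toB∩XInX H)                  ≡⟨ oddᵇ-add-twice (leavesXAt H) (toB∩XInX H) (toB∩XFrom∁X H) ⟩
          oddᵇ (cutEdgesAt H + (toB∩XInX H + toB∩XFrom∁X H)) ≡⟨ cong (λ t → oddᵇ (cutEdgesAt H + t)) (sym (toB∩X≡InX+From∁X H)) ⟩
          oddᵇ (cutEdgesAt H + toB∩X H) ∎
        where
        open ≡-Reasoning
        oddᵇ-add-twice : ∀ a b c → oddᵇ (a + b) ≡ oddᵇ ((a + c) + (b + c))
        oddᵇ-add-twice a b c = begin
          oddᵇ (a + b)                         ≡⟨ sym (Bool.xor-identityʳ (oddᵇ (a + b))) ⟩
          oddᵇ (a + b) xor false               ≡⟨ cong (oddᵇ (a + b) xor_) (sym (oddᵇ-double c)) ⟩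
          oddᵇ (a + b) xor oddᵇ (c + c)        ≡⟨ sym (oddᵇ-+ (a + b) (c + c)) ⟩
          oddᵇ ((a + b) + (c + c))             ≡⟨ cong oddᵇ (interchange a b c) ⟩
          oddᵇ ((a + c) + (b + c)) ∎
          where
          interchange : ∀ a b c → (a + b) + (c + c) ≡ (a + c) + (b + c)
          interchange = solve-∀

      toB∩X⇒toB : ∀ H v → χ (B ∩ X) (mate v) ∧ χ H v ≡ true → χ B (mate v) ∧ χ H v ≡ true
      toB∩X⇒toB H v e with ∧-true⁻ {χ (B ∩ X) (mate v)} e
      ... | inB∩X , inH = ∧-true⁺ (proj₁ (∧-true⁻ {χ B (mate v)} (trans (sym (χ∩ B X (mate v))) inB∩X))) inH

      toB∩X≤1 : ∀ {H} → H ∈ₗ Hs → toB∩X H ≤ 1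
      toB∩X≤1 {H} H∈Hs = ≤-trans (count-mono _ _ (toB∩X⇒toB H)) (≤-trans (ℕ.≤-reflexive (matchedIntoS≡odd H∈Hs)) (𝟙≤1 _))

      oddInX≡toB∩X : ∀ {H} → H ∈ₗ Hs → cutEdgesAt H ≡ 0 → oddInX H ≡ toB∩X H
      oddInX≡toB∩X {H} H∈Hs no-cut-edge =
        trans (cong 𝟙 (trans (oddᵇ-∣H∩X∣ H∈Hs) (cong (λ c → oddᵇ (c + toB∩X H)) no-cut-edge))) (𝟙-oddᵇ (toB∩X H) (toB∩X≤1 H∈Hs))

      #oddInX+toB∩X≡∣B∩X∣+oddInX : ∀ {H} → H ∈ₗ Hs → 1 ≤ cutEdgesAt H → length (oddIn X Hs) + toB∩X H ≡ ∣ B ∩ X ∣ + oddInX H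
      #oddInX+toB∩X≡∣B∩X∣+oddInX {H} H∈Hs 1≤cut = begin
        length (oddIn X Hs) + toB∩X H ≡⟨ cong (_+ toB∩X H) (#oddIn≡∑ₗ X Hs) ⟩
        ∑ₗ oddInX Hs + toB∩X H        ≡⟨ ∑ₗ-agree-off-unique-support cutEdgesAt oddInX toB∩X Hs H∈Hs 1≤cut
                                           (ℕ.≤-reflexive ∑ₗcutEdgesAt≡1) (λ _ → oddInX≡toB∩X) ⟩
        ∑ₗ toB∩X Hs + oddInX H        ≡⟨ cong (_+ oddInX H) ∑ₗtoB∩X≡∣B∩X∣ ⟩
        ∣ B ∩ X ∣ + oddInX H ∎
        where open ≡-Reasoning

    module Witness {K : Subset (n G)} (K∈ : K ∈ₗ oddIn X Hs) {u w : Fin (n G)}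
                   (u∈K : u ∈ K) (w∈B : w ∈ B) (w∉X : w ∉ X) (uw : Adjacent G u w) where

      K∈Hs : K ∈ₗ Hs
      K∈Hs = proj₁ (Membership.∈-filter⁻ (λ S → isOdd? ∣ S ∩ X ∣) {xs = Hs} K∈)

      oddInX[K]≡1 : oddInX K ≡ 1
      oddInX[K]≡1 = cong 𝟙 (IsOdd⇒oddᵇ ∣ K ∩ X ∣ (proj₂ (Membership.∈-filter⁻ (λ S → isOdd? ∣ S ∩ X ∣) {xs = Hs} K∈)))

      M₀ : ESet G
      M₀ = proj₁ (edge-in-perfect-matching G-mc uw)

      M₀-perfect : PerfectMatching G M₀
      M₀-perfect = proj₁ (proj₂ (edge-in-perfect-matching G-mc uw))

      module U₀ = UnderMatching M₀ M₀-perfect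
      open Mates {G = G} M₀ M₀-perfect using (mate)
      open MatchedInto {G = G} B Hs-components M₀ M₀-perfect using (matchedIntoS; module WhenBarrier)

      -- u is the only vertex of K matched into B, and its mate w is outside X.
      toB∩X[K]≡0 : U₀.toB∩X K ≡ 0
      toB∩X[K]≡0 = ℕ.n≤0⇒n≡0 (ℕ.≤-pred (≤-trans toB∩X<matchedIntoS (ℕ.≤-reflexive matchedIntoS≡1)))
        where
        mate-u≡w : mate u ≡ w
        mate-u≡w = proj₂ (proj₂ (edge-in-perfect-matching G-mc uw))
        matchedIntoS≡1 : matchedIntoS K ≡ 1
        matchedIntoS≡1 = trans (WhenBarrier.matchedIntoS≡odd #odd≡∣B∣ K∈Hs) (cong 𝟙 (components-odd K∈Hs))
        toB∩X<matchedIntoS : U₀.toB∩X K < matchedIntoS K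
        toB∩X<matchedIntoS = count-< _ _ (U₀.toB∩X⇒toB K) u
          (∧-true⁺ (trans (cong (χ B) mate-u≡w) (∈⇒χ w∈B)) (∈⇒χ u∈K))
          (cong (_∧ χ K u) (trans (cong (χ (B ∩ X)) mate-u≡w) (∉⇒χ≡false (w∉X ∘ proj₂ ∘ x∈p∩q⁻ B X))))

      cutEdgesAt[K]≥1 : 1 ≤ U₀.cutEdgesAt K
      cutEdgesAt[K]≥1 with U₀.cutEdgesAt K in no-cut-edge
      ... | suc _ = s≤s z≤n
      ... | zero = ⊥-elim (ℕ.1+n≢0 (trans (sym oddInX[K]≡1) (trans (U₀.oddInX≡toB∩X K∈Hs no-cut-edge) toB∩X[K]≡0)))

      ∣B∩X∣+1≡#oddInX : ∣ B ∩ X ∣ + 1 ≡ length (oddIn X Hs)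
      ∣B∩X∣+1≡#oddInX = begin
        ∣ B ∩ X ∣ + 1                    ≡⟨ cong (∣ B ∩ X ∣ +_) (sym oddInX[K]≡1) ⟩
        ∣ B ∩ X ∣ + oddInX K             ≡⟨ sym (U₀.#oddInX+toB∩X≡∣B∩X∣+oddInX K∈Hs cutEdgesAt[K]≥1) ⟩
        length (oddIn X Hs) + U₀.toB∩X K ≡⟨ cong (length (oddIn X Hs) +_) toB∩X[K]≡0 ⟩
        length (oddIn X Hs) + 0          ≡⟨ ℕ.+-identityʳ _ ⟩
        length (oddIn X Hs) ∎
        where open ≡-Reasoning

      ∣B∩∁X∣≡#oddIn∁X+1 : ∣ B ∩ ∁ X ∣ ≡ length (oddIn (∁ X) Hs) + 1
      ∣B∩∁X∣≡#oddIn∁X+1 = ℕ.+-cancelˡ-≡ ∣ B ∩ X ∣ _ _ (begin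
        ∣ B ∩ X ∣ + ∣ B ∩ ∁ X ∣                       ≡⟨ sym (∣∣≡∣∩∣+∣∩∁∣ B X) ⟩
        ∣ B ∣                                         ≡⟨ ∣B∣≡#oddInX+#oddIn∁X ⟩
        length (oddIn X Hs) + length (oddIn (∁ X) Hs) ≡⟨ cong (_+ length (oddIn (∁ X) Hs)) (sym ∣B∩X∣+1≡#oddInX) ⟩
        ∣ B ∩ X ∣ + 1 + length (oddIn (∁ X) Hs)       ≡⟨ +-assoc ∣ B ∩ X ∣ 1 _ ⟩
        ∣ B ∩ X ∣ + (1 + length (oddIn (∁ X) Hs))     ≡⟨ cong (∣ B ∩ X ∣ +_) (+-comm 1 _) ⟩
        ∣ B ∩ X ∣ + (length (oddIn (∁ X) Hs) + 1) ∎)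
        where open ≡-Reasoning

      ∈oddIn∁X⁻ : ∀ {H} → H ∈ₗ oddIn (∁ X) Hs → H ∈ₗ Hs × oddᵇ ∣ H ∩ ∁ X ∣ ≡ true × oddInX H ≡ 0
      ∈oddIn∁X⁻ {H} H∈ with Membership.∈-filter⁻ (λ S → isOdd? ∣ S ∩ ∁ X ∣) {xs = Hs} H∈
      ... | H∈Hs , odd = H∈Hs , odd′ , ℕ.+-cancelʳ-≡ 1 (oddInX H) 0
              (trans (cong (oddInX H +_) (sym (cong 𝟙 odd′))) (oddInX+oddIn∁X≡1 H∈Hs))
        where
        odd′ = IsOdd⇒oddᵇ ∣ H ∩ ∁ X ∣ odd

      module _ (M : ESet G) (M-perfect : PerfectMatching G M) where
        open UnderMatching M M-perfect

        -- Otherwise H would carry the cut edge of M, and ∑ oddInX would drop to |B ∩ X| - 1.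
        evenInX⇒toB∩X≡0 : ∀ {H} → H ∈ₗ Hs → oddInX H ≡ 0 → toB∩X H ≡ 0
        evenInX⇒toB∩X≡0 {H} H∈Hs even with toB∩X H in toB∩X≡ | toB∩X≤1 H∈Hs
        ... | zero | _ = refl
        ... | suc (suc _) | s≤s ()
        ... | suc zero | _ = ⊥-elim (ℕ.m≢1+m+n ∣ B ∩ X ∣ (sym (begin
            suc (∣ B ∩ X ∣ + 1)           ≡⟨ +-comm 1 (∣ B ∩ X ∣ + 1) ⟩
            ∣ B ∩ X ∣ + 1 + 1             ≡⟨ cong (_+ 1) ∣B∩X∣+1≡#oddInX ⟩
            length (oddIn X Hs) + 1       ≡⟨ cong (length (oddIn X Hs) +_) (sym toB∩X≡) ⟩
            length (oddIn X Hs) + toB∩X H ≡⟨ #oddInX+toB∩X≡∣B∩X∣+oddInX H∈Hs cut-edge ⟩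
            ∣ B ∩ X ∣ + oddInX H          ≡⟨ cong (∣ B ∩ X ∣ +_) even ⟩
            ∣ B ∩ X ∣ + 0                 ≡⟨ ℕ.+-identityʳ _ ⟩
            ∣ B ∩ X ∣ ∎)))
          where
          open ≡-Reasoning
          cut-edge : 1 ≤ cutEdgesAt H
          cut-edge with cutEdgesAt H in no-cut-edge
          ... | suc _ = s≤s z≤n
          ... | zero = ⊥-elim (ℕ.0≢1+n (trans (sym even) (trans (oddInX≡toB∩X H∈Hs no-cut-edge) toB∩X≡)))

      oddIn∁X-¬adjacent-B∩X : ∀ {H} → H ∈ₗ oddIn (∁ X) Hs → ∀ a b → a ∈ H → b ∈ B ∩ X → ¬ Adjacent G a b
      oddIn∁X-¬adjacent-B∩X {H} H∈ a b a∈H b∈B∩X ab with ∈oddIn∁X⁻ H∈ | edge-in-perfect-matching G-mc ab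
      ... | H∈Hs , _ , even | M , M-perfect , mate-a≡b = ℕ.<⇒≱ (subst (0 <_) (evenInX⇒toB∩X≡0 M M-perfect H∈Hs even) a-counted) ≤-refl
        where
        a-counted : 1 ≤ UnderMatching.toB∩X M M-perfect H
        a-counted = count-pos (λ v → χ (B ∩ X) (Mates.mate {G = G} M M-perfect v) ∧ χ H v) a
                              (∧-true⁺ (trans (cong (χ (B ∩ X)) mate-a≡b) (∈⇒χ b∈B∩X)) (∈⇒χ a∈H))

      -- An edge of ∂X inside H lies in some perfect matching, where it is the cut edge at H and makes |H ∩ X| odd.
      oddIn∁X⊆∁X : ∀ {H} → H ∈ₗ oddIn (∁ X) Hs → H ⊆ ∁ X
      oddIn∁X⊆∁X {H} H∈ {x} x∈H with x ∈? X
      ... | no x∉X = x∉p⇒x∈∁p x∉X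
      ... | yes x∈X with ∈oddIn∁X⁻ H∈
      ... | H∈Hs , odd∁X , even with Hs⇒IsComponent H∈Hs | 1≤∣∣⇒Nonempty (H ∩ ∁ X) (oddᵇ⇒pos _ odd∁X)
      ... | _ , _ , connected , closed | y , y∈H∩∁X with x∈p∩q⁻ H (∁ X) y∈H∩∁X
      ... | y∈H , y∈∁X with reach-leaves X (connected x∈H y∈H) x∈X (x∈∁p⇒x∉p y∈∁X)
      ... | a , b , x↝a , a∈X , b∉X , ab with edge-in-perfect-matching G-mc ab
      ... | M , M-perfect , mate-a≡b = ⊥-elim (true≢false (begin
            true                          ≡⟨⟩
            oddᵇ 1                        ≡⟨ cong oddᵇ (sym (ℕ.≤-antisym cut≤1 1≤cut)) ⟩
            oddᵇ (cutEdgesAt H)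
              ≡⟨ cong oddᵇ (sym (trans (cong (cutEdgesAt H +_) (evenInX⇒toB∩X≡0 M M-perfect H∈Hs even)) (ℕ.+-identityʳ _))) ⟩
            oddᵇ (cutEdgesAt H + toB∩X H) ≡⟨ sym (oddᵇ-∣H∩X∣ H∈Hs) ⟩
            oddᵇ ∣ H ∩ X ∣                ≡⟨ even⇒oddᵇ≡false {∣ H ∩ X ∣} even ⟩
            false ∎))
        where
        open UnderMatching M M-perfect
        open ≡-Reasoning
        1≤cut : 1 ≤ cutEdgesAt H
        1≤cut = ≤-trans (count-pos (λ v → leavesX v ∧ χ H v) a
                          (∧-true⁺ (∧-true⁺ (∈⇒χ a∈X) (cong not (trans (cong (χ X) mate-a≡b) (∉⇒χ≡false b∉X)))) (∈⇒χ (closed x∈H x↝a))))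
                        (ℕ.m≤m+n _ _)
        cut≤1 : cutEdgesAt H ≤ 1
        cut≤1 = ≤-trans (term≤∑ₗ cutEdgesAt H∈Hs) (ℕ.≤-reflexive ∑ₗcutEdgesAt≡1)
        even⇒oddᵇ≡false : ∀ {k} → 𝟙 (oddᵇ k) ≡ 0 → oddᵇ k ≡ false
        even⇒oddᵇ≡false {k} e with oddᵇ k
        ... | false = refl

      oddIn∁X-IsComponent : ∀ {H} → H ∈ₗ oddIn (∁ X) Hs → IsComponent G (B ∩ ∁ X) H
      oddIn∁X-IsComponent {H} H∈ with Hs⇒IsComponent (proj₁ (∈oddIn∁X⁻ H∈))
      ... | nonempty , H⊆∁B , connected , closed = nonempty , ∁B⊆∁S ∘ H⊆∁B , (λ a b → reach-mono ∁B⊆∁S (connected a b)) , closed′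
        where
        ∁B⊆∁S : ∁ B ⊆ ∁ (B ∩ ∁ X)
        ∁B⊆∁S x∈∁B = x∉p⇒x∈∁p (λ x∈S → x∈∁p⇒x∉p x∈∁B (proj₁ (x∈p∩q⁻ B (∁ X) x∈S)))
        closed′ : ∀ {a b} → a ∈ H → Reach G (∁ (B ∩ ∁ X)) a b → b ∈ H
        closed′ a∈H (here _) = a∈H
        closed′ a∈H (step {w = c} _ ac r) with c ∈? B
        ... | no c∉B = closed′ (closed a∈H (step (H⊆∁B a∈H) ac (here (x∉p⇒x∈∁p c∉B)))) r
        ... | yes c∈B with c ∈? X
        ... | yes c∈X = ⊥-elim (oddIn∁X-¬adjacent-B∩X H∈ _ c a∈H (x∈p∩q⁺ (c∈B , c∈X)) ac)
        ... | no c∉X = ⊥-elim (x∈∁p⇒x∉p (reach-head r) (x∈p∩q⁺ (c∈B , x∉p⇒x∈∁p c∉X)))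

      module ComponentsOfB∩∁X = ComponentsOf {G = G} (B ∩ ∁ X)

      #odd[B∩∁X]≡∣B∩∁X∣ : length (oddOnes ComponentsOfB∩∁X.components) ≡ ∣ B ∩ ∁ X ∣
      #odd[B∩∁X]≡∣B∩∁X∣ = trans (squeeze-by-parity _ _ lower upper same-parity) (sym ∣B∩∁X∣≡1+#oddIn∁X)
        where
        open MatchedInto {G = G} (B ∩ ∁ X) ComponentsOfB∩∁X.components-Components M₀ M₀-perfect
        ∣B∩∁X∣≡1+#oddIn∁X : ∣ B ∩ ∁ X ∣ ≡ suc (length (oddIn (∁ X) Hs))
        ∣B∩∁X∣≡1+#oddIn∁X = trans ∣B∩∁X∣≡#oddIn∁X+1 (+-comm _ 1)
        lower : length (oddIn (∁ X) Hs) ≤ length (oddOnes ComponentsOfB∩∁X.components)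
        lower = Unique⇒length-≤ _ _ (Unique.filter⁺ _ (proj₁ Hs-components)) λ H H∈ →
          Membership.∈-filter⁺ (λ S → isOdd? ∣ S ∣)
            (Equivalence.from (proj₂ ComponentsOfB∩∁X.components-Components H) (oddIn∁X-IsComponent H∈))
            (oddᵇ⇒IsOdd ∣ H ∣ (components-odd (proj₁ (∈oddIn∁X⁻ H∈))))
        upper : length (oddOnes ComponentsOfB∩∁X.components) ≤ suc (length (oddIn (∁ X) Hs))
        upper = subst (length (oddOnes ComponentsOfB∩∁X.components) ≤_) ∣B∩∁X∣≡1+#oddIn∁X #odd≤∣S∣
        same-parity : oddᵇ (length (oddOnes ComponentsOfB∩∁X.components)) ≡ oddᵇ (suc (length (oddIn (∁ X) Hs)))
        same-parity = trans oddᵇ-#odd≡oddᵇ-∣S∣ (cong oddᵇ ∣B∩∁X∣≡1+#oddIn∁X)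

      B∩∁X-sheltered : Sheltered X (B ∩ ∁ X)
      B∩∁X-sheltered = inj₂ (proj₂ ∘ x∈p∩q⁻ B (∁ X))

      B∩∁X-barrier : Barrier G (B ∩ ∁ X)
      B∩∁X-barrier = (w , x∈p∩q⁺ (w∈B , x∉p⇒x∈∁p w∉X)) ,
        ComponentsOfB∩∁X.components , ComponentsOfB∩∁X.components-Components , #odd[B∩∁X]≡∣B∩∁X∣

      -- Each laminarity case for the component H of v contradicts one of: |H ∩ X| odd, |B| ≥ 2, v ∈ H - X, w ∈ B - X.
      no-∈oddIn∁X⁻∁X⊆B : Avoiding G X B → 2 ≤ ∣ B ∣ → length (oddIn (∁ X) Hs) ≡ 0 → ∁ X ⊆ B
      no-∈oddIn∁X⁻∁X⊆B avoiding 2≤∣B∣ none {v} v∈∁X with v ∈? B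
      ... | yes v∈B = v∈B
      ... | no v∉B = ⊥-elim (not-laminar (avoiding H (Hs⇒IsComponent H∈Hs)))
        where
        H = component v
        H∈Hs = component∈Hs v∉B
        H⊆∁B = proj₁ (proj₂ (Hs⇒IsComponent H∈Hs))
        oddInX[H]≡1 : oddInX H ≡ 1
        oddInX[H]≡1 = trans (sym (ℕ.+-identityʳ _)) (trans (cong (oddInX H +_) (sym oddIn∁X[H]≡0)) (oddInX+oddIn∁X≡1 H∈Hs))
          where
          oddIn∁X[H]≡0 = ∑ₗ≡0⇒term≡0 oddIn∁X H∈Hs (trans (sym (#oddIn≡∑ₗ (∁ X) Hs)) none)
        𝟙≡1⇒true : ∀ {b} → 𝟙 b ≡ 1 → b ≡ true
        𝟙≡1⇒true {true} _ = refl
        ∣B∣≡1 : Empty (∁ H ∩ X) → ∣ B ∣ ≡ 1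
        ∣B∣≡1 X⊆H = begin
          ∣ B ∣                   ≡⟨ ∣∣≡∣∩∣+∣∩∁∣ B X ⟩
          ∣ B ∩ X ∣ + ∣ B ∩ ∁ X ∣ ≡⟨ cong (_+ ∣ B ∩ ∁ X ∣) (trans (cong ∣_∣ (Empty-unique B∩X-empty)) (∣⊥∣≡0 (n G))) ⟩
          ∣ B ∩ ∁ X ∣             ≡⟨ ∣B∩∁X∣≡#oddIn∁X+1 ⟩
          length (oddIn (∁ X) Hs) + 1 ≡⟨ cong (_+ 1) none ⟩
          1 ∎
          where
          open ≡-Reasoning
          B∩X-empty : Empty (B ∩ X)
          B∩X-empty (x , x∈B∩X) with x∈p∩q⁻ B X x∈B∩X
          ... | x∈B , x∈X with x ∈? H
          ... | yes x∈H = x∈∁p⇒x∉p (H⊆∁B x∈H) x∈B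
          ... | no x∉H = X⊆H (x , x∈p∩q⁺ (x∉p⇒x∈∁p x∉H , x∈X))
        not-laminar : ¬ Laminar H X
        not-laminar (inj₁ H∩X-empty) = H∩X-empty (1≤∣∣⇒Nonempty (H ∩ X) (oddᵇ⇒pos _ (𝟙≡1⇒true oddInX[H]≡1)))
        not-laminar (inj₂ (inj₁ X⊆H)) = ℕ.<⇒≱ 2≤∣B∣ (ℕ.≤-reflexive (∣B∣≡1 X⊆H))
        not-laminar (inj₂ (inj₂ (inj₁ H⊆X))) = H⊆X (v , x∈p∩q⁺ (∈component v∉B , v∈∁X))
        not-laminar (inj₂ (inj₂ (inj₂ H∪X-full))) =
          H∪X-full (w , x∈p∩q⁺ (x∉p⇒x∈∁p (λ w∈H → x∈∁p⇒x∉p (H⊆∁B w∈H) w∈B) , x∉p⇒x∈∁p w∉X))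

      2≤∣B∩∁X∣ : NontrivialCut X → Avoiding G X B → 2 ≤ ∣ B ∣ → 2 ≤ ∣ B ∩ ∁ X ∣
      2≤∣B∩∁X∣ (_ , 2≤∣∁X∣) avoiding 2≤∣B∣ with length (oddIn (∁ X) Hs) in #oddIn∁X
      ... | suc k = subst (2 ≤_) (sym (trans ∣B∩∁X∣≡#oddIn∁X+1 (cong (_+ 1) #oddIn∁X))) (s≤s (ℕ.m≤n+m 1 k))
      ... | zero = ⊥-elim (ℕ.<⇒≱ (≤-trans 2≤∣∁X∣ ∣∁X∣≤1) ≤-refl)
        where
        ∣∁X∣≤1 : ∣ ∁ X ∣ ≤ 1
        ∣∁X∣≤1 = ≤-trans (p⊆q⇒∣p∣≤∣q∣ λ v∈∁X → x∈p∩q⁺ (no-∈oddIn∁X⁻∁X⊆B avoiding 2≤∣B∣ #oddIn∁X v∈∁X , v∈∁X))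
                         (ℕ.≤-reflexive (trans ∣B∩∁X∣≡#oddIn∁X+1 (cong (_+ 1) #oddIn∁X)))

lemma2p2 : (G : Graph) → MatchingCovered G →
    (X : VSet G) → Tight G (∂ G X) →
    (B : VSet G) → Barrier G B →
    (Hs : List (VSet G)) → Components G B Hs →
    (∃[ K ] (K ∈ₗ oddIn X Hs × ∃[ u ] ∃[ w ] (u ∈ K × w ∈ B × w ∉ X × Adjacent G u w))) →
    ((∣ B ∩ X ∣ + 1 ≡ length (oddIn X Hs)) × (∣ B ∩ ∁ X ∣ ≡ length (oddIn (∁ X) Hs) + 1))
    × (∀ H → H ∈ₗ oddIn (∁ X) Hs →
         H ⊆ ∁ X × (∀ u w → u ∈ H → w ∈ B ∩ X → ¬ Adjacent G u w))
    × (Barrier G (B ∩ ∁ X) × Sheltered X (B ∩ ∁ X))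
    × (NontrivialCut X → Avoiding G X B → 2 ≤ ∣ B ∣ →
         Barrier G (B ∩ ∁ X) × 2 ≤ ∣ B ∩ ∁ X ∣ × Sheltered X (B ∩ ∁ X))
lemma2p2 G G-mc X X-tight B B-barrier Hs Hs-components (K , K∈ , u , w , u∈K , w∈B , w∉X , uw) =
  (∣B∩X∣+1≡#oddInX , ∣B∩∁X∣≡#oddIn∁X+1) ,
  (λ H H∈ → oddIn∁X⊆∁X H∈ , oddIn∁X-¬adjacent-B∩X H∈) ,
  (B∩∁X-barrier , B∩∁X-sheltered) ,
  (λ nontrivial avoiding 2≤∣B∣ → B∩∁X-barrier , 2≤∣B∩∁X∣ nontrivial avoiding 2≤∣B∣ , B∩∁X-sheltered)
  where
  open MatchingCoveredBarrier G G-mc B B-barrier Hs-components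
  open AcrossTightCut X X-tight
  open Witness K∈ u∈K w∈B w∉X uw
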